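{- For every stoup $S$, context $\Gamma$ and formula $C$, the translation $\mathrm{sound}$ induces a bijection between $\circeq$-equivalence classes of cut-free derivations of $S \mid \Gamma \vdash C$ and $\doteq$-equivalence classes of categorical-calculus derivations $\llbracket S \mid \Gamma \rrbracket \Rightarrow C$ (i.e., $\mathrm{sound}$ respects $\circeq$, every derivation $\llbracket S \mid \Gamma\rrbracket \Rightarrow C$ is $\doteq$ to $\mathrm{sound}\, f$ for some cut-free $f$, and $\mathrm{sound}\, f \doteq \mathrm{sound}\, g$ implies $f \circeq g$). In particular, $\circeq$-classes of cut-free derivations of $A \mid\ \vdash C$ are in bijection with $\doteq$-classes of derivations $A \Rightarrow C$, i.e. with morphisms $A \to C$ of the free skew monoidal category on $\mathrm{Var}$.
   Context: Fix a set $\mathrm{Var}$ of atoms. Formulae: atoms $X \in \mathrm{Var}$, $\mathsf{I}$, and $A \otimes B$ for formulae $A, B$. A context is a finite list of formulae; a stoup $S$ is either empty (written $-$) or a single formula. Categorical calculus: judgements $A \Rightarrow C$ derived by $\mathrm{id}_A : A \Rightarrow A$; $g \circ f : A \Rightarrow C$ from $f : A \Rightarrow B$, $g : B \Rightarrow C$; $f \otimes g : A \otimes B \Rightarrow C \otimes D$ from $f : A \Rightarrow C$, $g : B \Rightarrow D$; axioms $\lambda_A : \mathsf{I} \otimes A \Rightarrow A$, $\rho_A : A \Rightarrow A \otimes \mathsf{I}$, $\alpha_{A,B,C} : (A \otimes B) \otimes C \Rightarrow A \otimes (B \otimes C)$. The relation $\doteq$ is the least congruence (w.r.t. $\circ$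 and $\otimes$) containing: $f \circ \mathrm{id} \doteq f \doteq \mathrm{id} \circ f$; $h \circ (g \circ f) \doteq (h \circ g) \circ f$; $\mathrm{id}_A \otimes \mathrm{id}_B \doteq \mathrm{id}_{A \otimes B}$; $(h \circ f) \otimes (k \circ g) \doteq (h \otimes k) \circ (f \otimes g)$; $\lambda_B \circ (\mathrm{id}_{\mathsf I} \otimes f) \doteq f \circ \lambda_A$; $(f \otimes \mathrm{id}_{\mathsf I}) \circ \rho_A \doteq \rho_B \circ f$; $(f \otimes (g \otimes h)) \circ \alpha \doteq \alpha \circ ((f \otimes g) \otimes h)$; $\lambda_{\mathsf I} \circ \rho_{\mathsf I} \doteq \mathrm{id}_{\mathsf I}$; $(\mathrm{id}_A \otimes \lambda_B) \circ \alpha_{A,\mathsf I,B} \circ (\rho_A \otimes \mathrm{id}_B) \doteq \mathrm{id}_{A \otimes B}$; $\lambda_{A \otimes B} \circ \alpha_{\mathsf I,A,B} \doteq \lambda_A \otimes \mathrm{id}_B$; $\alpha_{A,B,\mathsf I} \circ \rho_{A \otimes B} \doteq \mathrm{id}_A \otimes \rho_B$; $\alpha_{A,B,C \otimes D} \circ \alpha_{A \otimes B,C,D} \doteq (\mathrm{id}_A \otimes \alpha_{B,C,D}) \circ \alpha_{A,B \otimes C,D} \circ (\alpha_{A,B,C} \otimes \mathrm{id}_D)$. The $\doteq$-classes are the morphisms of the free skew monoidal category on $\mathrm{Var}$. Cut-free sequent calculus: sequents $S \mid \Gamma \vdash C$ derived by (ax) $A \mid\ \vdash A$; (pass) from $A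 \mid \Gamma \vdash C$ infer $- \mid A, \Gamma \vdash C$; ($\mathsf I$L) from $- \mid \Gamma \vdash C$ infer $\mathsf I \mid \Gamma \vdash C$; ($\mathsf I$R) $- \mid\ \vdash \mathsf I$; ($\otimes$L) from $A \mid B, \Gamma \vdash C$ infer $A \otimes B \mid \Gamma \vdash C$; ($\otimes$R) from $S \mid \Gamma \vdash A$ and $- \mid \Delta \vdash B$ infer $S \mid \Gamma, \Delta \vdash A \otimes B$. The relation $\circeq$ is the least congruence on cut-free derivations containing: $\mathrm{ax}_{\mathsf I} \circeq \mathsf{I}\mathrm{L}(\mathsf I\mathrm R)$; $\mathrm{ax}_{A \otimes B} \circeq \otimes\mathrm L(\otimes\mathrm R(\mathrm{ax}_A, \mathrm{pass}(\mathrm{ax}_B)))$; $\otimes\mathrm R(\mathrm{pass}\, f, g) \circeq \mathrm{pass}(\otimes\mathrm R(f, g))$; $\otimes\mathrm R(\mathsf I\mathrm L\, f, g) \circeq \mathsf I\mathrm L(\otimes\mathrm R(f, g))$; $\otimes\mathrm R(\otimes\mathrm L\, f, g) \circeq \otimes\mathrm L(\otimes\mathrm R(f, g))$. Interpretation: $\llbracket - \rrbracket = \mathsf I$, $\llbracket A \rrbracket = A$; $\llbracket S \mid A_1,\dots,A_n \rrbracket = (\cdots(\llbracket S \rrbracket \otimes A_1)\cdots) \otimes A_n$. For $f : A \Rightarrow B$: $\llbracket f \mid () \rrbracket = f$, $\llbracket f \mid C, \Gamma \rrbracket = \llbracket f \otimes \mathrm{id}_C \mid \Gamma \rrbracket$.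 Define $\psi_{A,B,()} = \mathrm{id}_{A \otimes B}$, $\psi_{A,B,(C,\Gamma)} = \psi_{A,B \otimes C,\Gamma} \circ \llbracket \alpha_{A,B,C} \mid \Gamma \rrbracket$; $\varphi'_{A,(),\Delta} = \psi_{A,\mathsf I,\Delta} \circ \llbracket \rho_A \mid \Delta \rrbracket$, $\varphi'_{A,(C,\Gamma),\Delta} = \varphi'_{A \otimes C,\Gamma,\Delta}$, $\varphi_{S,\Gamma,\Delta} = \varphi'_{\llbracket S \rrbracket,\Gamma,\Delta} : \llbracket S \mid \Gamma,\Delta \rrbracket \Rightarrow \llbracket S \mid \Gamma \rrbracket \otimes \llbracket - \mid \Delta \rrbracket$. The translation $\mathrm{sound}$ from cut-free derivations of $S \mid \Gamma \vdash C$ to derivations $\llbracket S \mid \Gamma \rrbracket \Rightarrow C$: $\mathrm{sound}(\mathrm{ax}_C) = \mathrm{id}_C$; $\mathrm{sound}(\mathrm{pass}\, f) = \mathrm{sound}\, f \circ \llbracket \lambda_A \mid \Gamma' \rrbracket$ for $f : A \mid \Gamma' \vdash C$; $\mathrm{sound}(\mathsf I\mathrm L\, f) = \mathrm{sound}\, f$; $\mathrm{sound}(\otimes\mathrm L\, f) = \mathrm{sound}\, f$; $\mathrm{sound}(\mathsf I\mathrm R) = \mathrm{id}_{\mathsf I}$; $\mathrm{sound}(\otimes\mathrm R(f_1, f_2)) = (\mathrm{sound}\, f_1 \otimes \mathrm{sound}\, f_2) \circ \varphi_{S,\Gamma_1,\Gamma_2}$ for $f_1 : S \mid \Gamma_1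 \vdash C_1$, $f_2 : - \mid \Gamma_2 \vdash C_2$. -}

module Defs where

open import Data.List using (List; []; _∷_; _++_)
open import Data.Maybe using (Maybe; just; nothing)

module _ {Var : Set} where

  infixl 25 _⊗_
  data Fma : Set where
    ` : Var → Fma
    I : Fma
    _⊗_ : Fma → Fma → Fma

  -- stoup: nothing = empty stoup (-), just A = formula A
  Stp : Set
  Stp = Maybe Fma

  Cxt : Set
  Cxt = List Fma

  infix 15 _⇒_
  infixl 20 _∘_
  data _⇒_ : Fma → Fma → Set where
    id : {A : Fma} → A ⇒ A
    _∘_ : {A B C : Fma} → B ⇒ C → A ⇒ B → A ⇒ C
    _⊗⇒_ : {A B C D : Fma} → A ⇒ C → B ⇒ D → A ⊗ B ⇒ C ⊗ D
    l : {A : Fma} → I ⊗ A ⇒ A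
    ρ : {A : Fma} → A ⇒ A ⊗ I
    α : {A B C : Fma} → (A ⊗ B) ⊗ C ⇒ A ⊗ (B ⊗ C)

  infixl 19 _⊗⇒_

  infix 15 _≐_
  data _≐_ : {A B : Fma} → A ⇒ B → A ⇒ B → Set where
    refl≐ : {A B : Fma} {f : A ⇒ B} → f ≐ f
    ~_ : {A B : Fma} {f g : A ⇒ B} → f ≐ g → g ≐ f
    _∙_ : {A B : Fma} {f g h : A ⇒ B} → f ≐ g → g ≐ h → f ≐ h
    _∘≐_ : {A B C : Fma} {f g : B ⇒ C} {h k : A ⇒ B} → f ≐ g → h ≐ k → f ∘ h ≐ g ∘ k
    _⊗≐_ : {A B C D : Fma} {f g : A ⇒ C} {h k : B ⇒ D} → f ≐ g → h ≐ k → f ⊗⇒ h ≐ g ⊗⇒ k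
    lid : {A B : Fma} {f : A ⇒ B} → f ∘ id ≐ f
    rid : {A B : Fma} {f : A ⇒ B} → f ≐ id ∘ f
    ass : {A B C D : Fma} {f : A ⇒ B} {g : B ⇒ C} {h : C ⇒ D} → h ∘ (g ∘ f) ≐ (h ∘ g) ∘ f
    f⊗id : {A B : Fma} → id {A} ⊗⇒ id {B} ≐ id {A ⊗ B}
    f⊗∘ : {A B C D E F : Fma} {f : A ⇒ B} {g : D ⇒ E} {h : B ⇒ C} {k : E ⇒ F}
      → (h ∘ f) ⊗⇒ (k ∘ g) ≐ (h ⊗⇒ k) ∘ (f ⊗⇒ g)
    nl : {A B : Fma} {f : A ⇒ B} → l ∘ (id ⊗⇒ f) ≐ f ∘ l
    nρ : {A B : Fma} {f : A ⇒ B} → (f ⊗⇒ id) ∘ ρ ≐ ρ ∘ f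
    nα : {A B C D E F : Fma} {f : A ⇒ D} {g : B ⇒ E} {h : C ⇒ F}
      → (f ⊗⇒ (g ⊗⇒ h)) ∘ α ≐ α ∘ ((f ⊗⇒ g) ⊗⇒ h)
    lρ : l {I} ∘ ρ ≐ id
    lαρ : {A B : Fma} → (id ⊗⇒ l) ∘ α {A} {I} {B} ∘ (ρ ⊗⇒ id) ≐ id
    lα : {A B : Fma} → l ∘ α {I} {A} {B} ≐ l ⊗⇒ id
    αρ : {A B : Fma} → α {A} {B} {I} ∘ ρ ≐ id ⊗⇒ ρ
    ααα : {A B C D : Fma}
      → α {A} {B} {C ⊗ D} ∘ α {A ⊗ B} {C} {D}
        ≐ (id ⊗⇒ α) ∘ α ∘ (α ⊗⇒ id)

  infix 15 _∣_⊢_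
  data _∣_⊢_ : Stp → Cxt → Fma → Set where
    ax : {A : Fma} → just A ∣ [] ⊢ A
    pass : {Γ : Cxt} {A C : Fma} → just A ∣ Γ ⊢ C → nothing ∣ A ∷ Γ ⊢ C
    Il : {Γ : Cxt} {C : Fma} → nothing ∣ Γ ⊢ C → just I ∣ Γ ⊢ C
    Ir : nothing ∣ [] ⊢ I
    ⊗l : {Γ : Cxt} {A B C : Fma} → just A ∣ B ∷ Γ ⊢ C → just (A ⊗ B) ∣ Γ ⊢ C
    ⊗r : {S : Stp} {Γ Δ : Cxt} {A B : Fma}
      → S ∣ Γ ⊢ A → nothing ∣ Δ ⊢ B → S ∣ Γ ++ Δ ⊢ A ⊗ B

  infix 15 _≗_
  data _≗_ : {S : Stp} {Γ : Cxt} {C : Fma} → S ∣ Γ ⊢ C → S ∣ Γ ⊢ C → Set where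
    refl≗ : ∀ {S Γ C} {f : S ∣ Γ ⊢ C} → f ≗ f
    ~≗_ : ∀ {S Γ C} {f g : S ∣ Γ ⊢ C} → f ≗ g → g ≗ f
    _∙≗_ : ∀ {S Γ C} {f g h : S ∣ Γ ⊢ C} → f ≗ g → g ≗ h → f ≗ h
    pass≗ : ∀ {Γ A C} {f g : just A ∣ Γ ⊢ C} → f ≗ g → pass f ≗ pass g
    Il≗ : ∀ {Γ C} {f g : nothing ∣ Γ ⊢ C} → f ≗ g → Il f ≗ Il g
    ⊗l≗ : ∀ {Γ A B C} {f g : just A ∣ B ∷ Γ ⊢ C} → f ≗ g → ⊗l f ≗ ⊗l g
    ⊗r≗ : ∀ {S Γ Δ A B} {f g : S ∣ Γ ⊢ A} {f' g' : nothing ∣ Δ ⊢ B}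
      → f ≗ g → f' ≗ g' → ⊗r f f' ≗ ⊗r g g'
    axI : ax {I} ≗ Il Ir
    ax⊗ : ∀ {A B} → ax {A ⊗ B} ≗ ⊗l (⊗r ax (pass ax))
    ⊗rpass : ∀ {Γ Δ A A' B} {f : just A' ∣ Γ ⊢ A} {g : nothing ∣ Δ ⊢ B}
      → ⊗r (pass f) g ≗ pass (⊗r f g)
    ⊗rIl : ∀ {Γ Δ A B} {f : nothing ∣ Γ ⊢ A} {g : nothing ∣ Δ ⊢ B}
      → ⊗r (Il f) g ≗ Il (⊗r f g)
    ⊗r⊗l : ∀ {Γ Δ A A' B' B} {f : just A' ∣ B' ∷ Γ ⊢ A} {g : nothing ∣ Δ ⊢ B}
      → ⊗r (⊗l f) g ≗ ⊗l (⊗r f g)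

  t : Stp → Fma
  t nothing = I
  t (just A) = A

  ⟦_∣_⟧ : Fma → Cxt → Fma
  ⟦ A ∣ [] ⟧ = A
  ⟦ A ∣ C ∷ Γ ⟧ = ⟦ A ⊗ C ∣ Γ ⟧

  ⟦_∣_⟧ₛ : Stp → Cxt → Fma
  ⟦ S ∣ Γ ⟧ₛ = ⟦ t S ∣ Γ ⟧

  ⟦_∣_⟧f : {A B : Fma} → A ⇒ B → (Γ : Cxt) → ⟦ A ∣ Γ ⟧ ⇒ ⟦ B ∣ Γ ⟧
  ⟦ f ∣ [] ⟧f = f
  ⟦ f ∣ C ∷ Γ ⟧f = ⟦ f ⊗⇒ id {C} ∣ Γ ⟧f

  ψ : (A B : Fma) (Γ : Cxt) → ⟦ A ⊗ B ∣ Γ ⟧ ⇒ A ⊗ ⟦ B ∣ Γ ⟧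
  ψ A B [] = id
  ψ A B (C ∷ Γ) = ψ A (B ⊗ C) Γ ∘ ⟦ α {A} {B} {C} ∣ Γ ⟧f

  φ' : (A : Fma) (Γ Δ : Cxt) → ⟦ A ∣ Γ ++ Δ ⟧ ⇒ ⟦ A ∣ Γ ⟧ ⊗ ⟦ I ∣ Δ ⟧
  φ' A [] Δ = ψ A I Δ ∘ ⟦ ρ {A} ∣ Δ ⟧f
  φ' A (C ∷ Γ) Δ = φ' (A ⊗ C) Γ Δ

  φ : (S : Stp) (Γ Δ : Cxt) → ⟦ S ∣ Γ ++ Δ ⟧ₛ ⇒ ⟦ S ∣ Γ ⟧ₛ ⊗ ⟦ nothing ∣ Δ ⟧ₛ
  φ S = φ' (t S)

  sound : {S : Stp} {Γ : Cxt} {C : Fma} → S ∣ Γ ⊢ C → ⟦ S ∣ Γ ⟧ₛ ⇒ C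
  sound ax = id
  sound (pass {Γ} {A} f) = sound f ∘ ⟦ l {A} ∣ Γ ⟧f
  sound (Il f) = sound f
  sound Ir = id
  sound (⊗l f) = sound f
  sound (⊗r {S} {Γ} {Δ} f g) = (sound f ⊗⇒ sound g) ∘ φ S Γ Δ

-- sound is inverted through a right action of the categorical calculus on cut-free derivations:
-- for h : A ⇒ B, post h : S ∣ Γ ⊢ A → S ∣ Γ ⊢ B cuts against h, by recursion on h and on the
-- derivation. Every generating equation of ≐ turns into an instance of ≗, so post respects ≐,
-- and sound (post h k) ≐ h ∘ sound k. Surjectivity: post h ax derives ⟦ S ∣ Γ ⟧ₛ ∣ ⊢ C, and
-- inverting the left rules ⊗l and Il yields a derivation of S ∣ Γ ⊢ C with the same
-- denotation. Injectivity: every f is ≗ to post (sound f) (ax* S Γ), where the canonical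
-- derivation ax* S Γ : S ∣ Γ ⊢ ⟦ S ∣ Γ ⟧ₛ is built from ax, Ir, pass and ⊗r.

module Submission where

open import Data.List using ([]; _∷_; _++_)
open import Data.List.Properties using (++-assoc; ++-identityʳ)
open import Data.Maybe using (just; nothing)
open import Data.Product using (_×_; Σ; _,_)
open import Relation.Binary.Bundles using (Setoid)
open import Relation.Binary.PropositionalEquality using (_≡_; refl; sym; trans; cong; module ≡-Reasoning)
import Relation.Binary.Reasoning.Setoid as SetoidReasoning

-- Defs declares no fixities for these constructors; the renamings only add them.
open import Defs
  renaming ( _∙_ to infixr 4 _∙_; ~_ to infix 9 ~_; _∘≐_ to infixr 6 _∘≐_; _⊗≐_ to infixr 7 _⊗≐_
           ; _∙≗_ to infixr 4 _∙≗_; ~≗_ to infix 9 ~≗_)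

module _ {Var : Set} where

  private variable
    A A' B B' C D E G : Fma {Var}
    Γ Γ' Δ Λ : Cxt {Var}
    S : Stp {Var}

  ⇒-setoid : Fma {Var} → Fma {Var} → Setoid _ _
  ⇒-setoid A B = record
    { Carrier = A ⇒ B ; _≈_ = _≐_ ; isEquivalence = record { refl = refl≐ ; sym = ~_ ; trans = _∙_ } }

  module ≐-Reasoning {A B : Fma {Var}} = SetoidReasoning (⇒-setoid A B)

  ≡→≐ : {f g : A ⇒ B} → f ≡ g → f ≐ g
  ≡→≐ refl = refl≐

  split-∘⊗ˡ : {f : B ⇒ C} {g : A ⇒ B} {h : D ⇒ E} → (f ∘ g) ⊗⇒ h ≐ (f ⊗⇒ h) ∘ (g ⊗⇒ id)
  split-∘⊗ˡ = (refl≐ ⊗≐ ~ lid) ∙ f⊗∘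

  split-∘⊗ʳ : {f : B ⇒ C} {g : A ⇒ B} {h : D ⇒ E} → (f ∘ g) ⊗⇒ h ≐ (f ⊗⇒ id) ∘ (g ⊗⇒ h)
  split-∘⊗ʳ = (refl≐ ⊗≐ rid) ∙ f⊗∘

  split-⊗∘ : {f : A ⇒ B} {g : D ⇒ E} {h : C ⇒ D} → f ⊗⇒ (g ∘ h) ≐ (f ⊗⇒ g) ∘ (id ⊗⇒ h)
  split-⊗∘ = (~ lid ⊗≐ refl≐) ∙ f⊗∘

  id⊗-∘ : {f : B ⇒ C} {g : A ⇒ B} → (id {A = D} ⊗⇒ f) ∘ (id ⊗⇒ g) ≐ id ⊗⇒ (f ∘ g)
  id⊗-∘ = ~ f⊗∘ ∙ (lid ⊗≐ refl≐)

  ⟦⟧f-cong : (Γ : Cxt) {f g : A ⇒ B} → f ≐ g → ⟦ f ∣ Γ ⟧f ≐ ⟦ g ∣ Γ ⟧f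
  ⟦⟧f-cong []      p = p
  ⟦⟧f-cong (C ∷ Γ) p = ⟦⟧f-cong Γ (p ⊗≐ refl≐)

  ⟦⟧f-id : (Γ : Cxt) → ⟦ id {A = A} ∣ Γ ⟧f ≐ id
  ⟦⟧f-id []      = refl≐
  ⟦⟧f-id (C ∷ Γ) = ⟦⟧f-cong Γ f⊗id ∙ ⟦⟧f-id Γ

  ⟦⟧f-∘ : (Γ : Cxt) {f : B ⇒ C} {g : A ⇒ B} → ⟦ f ∘ g ∣ Γ ⟧f ≐ ⟦ f ∣ Γ ⟧f ∘ ⟦ g ∣ Γ ⟧f
  ⟦⟧f-∘ []      = refl≐
  ⟦⟧f-∘ (C ∷ Γ) = ⟦⟧f-cong Γ split-∘⊗ʳ ∙ ⟦⟧f-∘ Γ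

  ⟦⟧f-square : (Γ : Cxt) {f : B ⇒ D} {g : A ⇒ B} {h : B' ⇒ D} {k : A ⇒ B'}
    → f ∘ g ≐ h ∘ k → ⟦ f ∣ Γ ⟧f ∘ ⟦ g ∣ Γ ⟧f ≐ ⟦ h ∣ Γ ⟧f ∘ ⟦ k ∣ Γ ⟧f
  ⟦⟧f-square Γ p = ~ ⟦⟧f-∘ Γ ∙ ⟦⟧f-cong Γ p ∙ ⟦⟧f-∘ Γ

  -- Coherence of ψ and φ'

  ψ-natˡ : (Γ : Cxt) (h : A ⇒ A') → ψ A' B Γ ∘ ⟦ h ⊗⇒ id ∣ Γ ⟧f ≐ (h ⊗⇒ id) ∘ ψ A B Γ
  ψ-natˡ []      h = ~ rid ∙ ~ lid
  ψ-natˡ {A = A} {A' = A'} {B = B} (C ∷ Γ) h = begin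
    (ψ A' (B ⊗ C) Γ ∘ ⟦ α ∣ Γ ⟧f) ∘ ⟦ (h ⊗⇒ id) ⊗⇒ id ∣ Γ ⟧f   ≈⟨ ass ⟨
    ψ A' (B ⊗ C) Γ ∘ (⟦ α ∣ Γ ⟧f ∘ ⟦ (h ⊗⇒ id) ⊗⇒ id ∣ Γ ⟧f)
      ≈⟨ refl≐ ∘≐ ⟦⟧f-square Γ (~ nα ∙ (refl≐ ⊗≐ f⊗id) ∘≐ refl≐) ⟩
    ψ A' (B ⊗ C) Γ ∘ (⟦ h ⊗⇒ id ∣ Γ ⟧f ∘ ⟦ α ∣ Γ ⟧f)            ≈⟨ ass ⟩
    (ψ A' (B ⊗ C) Γ ∘ ⟦ h ⊗⇒ id ∣ Γ ⟧f) ∘ ⟦ α ∣ Γ ⟧f            ≈⟨ ψ-natˡ Γ h ∘≐ refl≐ ⟩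
    ((h ⊗⇒ id) ∘ ψ A (B ⊗ C) Γ) ∘ ⟦ α ∣ Γ ⟧f                    ≈⟨ ass ⟨
    (h ⊗⇒ id) ∘ ψ A B (C ∷ Γ)                                    ∎
    where open ≐-Reasoning

  ψ-natʳ : (Γ : Cxt) (h : B ⇒ B') → ψ A B' Γ ∘ ⟦ id ⊗⇒ h ∣ Γ ⟧f ≐ (id ⊗⇒ ⟦ h ∣ Γ ⟧f) ∘ ψ A B Γ
  ψ-natʳ []      h = ~ rid ∙ ~ lid
  ψ-natʳ {B = B} {B' = B'} {A = A} (C ∷ Γ) h = begin
    (ψ A (B' ⊗ C) Γ ∘ ⟦ α ∣ Γ ⟧f) ∘ ⟦ (id ⊗⇒ h) ⊗⇒ id ∣ Γ ⟧f   ≈⟨ ass ⟨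
    ψ A (B' ⊗ C) Γ ∘ (⟦ α ∣ Γ ⟧f ∘ ⟦ (id ⊗⇒ h) ⊗⇒ id ∣ Γ ⟧f)   ≈⟨ refl≐ ∘≐ ⟦⟧f-square Γ (~ nα) ⟩
    ψ A (B' ⊗ C) Γ ∘ (⟦ id ⊗⇒ (h ⊗⇒ id) ∣ Γ ⟧f ∘ ⟦ α ∣ Γ ⟧f)   ≈⟨ ass ⟩
    (ψ A (B' ⊗ C) Γ ∘ ⟦ id ⊗⇒ (h ⊗⇒ id) ∣ Γ ⟧f) ∘ ⟦ α ∣ Γ ⟧f   ≈⟨ ψ-natʳ Γ (h ⊗⇒ id) ∘≐ refl≐ ⟩
    ((id ⊗⇒ ⟦ h ⊗⇒ id ∣ Γ ⟧f) ∘ ψ A (B ⊗ C) Γ) ∘ ⟦ α ∣ Γ ⟧f   ≈⟨ ass ⟨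
    (id ⊗⇒ ⟦ h ⊗⇒ id ∣ Γ ⟧f) ∘ ψ A B (C ∷ Γ)                   ∎
    where open ≐-Reasoning

  φ'-nat : (Γ Δ : Cxt) (h : A ⇒ B) → φ' B Γ Δ ∘ ⟦ h ∣ Γ ++ Δ ⟧f ≐ (⟦ h ∣ Γ ⟧f ⊗⇒ id) ∘ φ' A Γ Δ
  φ'-nat (C ∷ Γ) Δ h = φ'-nat Γ Δ (h ⊗⇒ id)
  φ'-nat {A = A} {B = B} [] Δ h = begin
    (ψ B I Δ ∘ ⟦ ρ ∣ Δ ⟧f) ∘ ⟦ h ∣ Δ ⟧f         ≈⟨ ass ⟨
    ψ B I Δ ∘ (⟦ ρ ∣ Δ ⟧f ∘ ⟦ h ∣ Δ ⟧f)         ≈⟨ refl≐ ∘≐ ⟦⟧f-square Δ (~ nρ) ⟩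
    ψ B I Δ ∘ (⟦ h ⊗⇒ id ∣ Δ ⟧f ∘ ⟦ ρ ∣ Δ ⟧f)   ≈⟨ ass ⟩
    (ψ B I Δ ∘ ⟦ h ⊗⇒ id ∣ Δ ⟧f) ∘ ⟦ ρ ∣ Δ ⟧f   ≈⟨ ψ-natˡ Δ h ∘≐ refl≐ ⟩
    ((h ⊗⇒ id) ∘ ψ A I Δ) ∘ ⟦ ρ ∣ Δ ⟧f           ≈⟨ ass ⟨
    (h ⊗⇒ id) ∘ φ' A [] Δ                        ∎
    where open ≐-Reasoning

  φ'-nat-⊗ : (Γ Δ : Cxt) (h : A ⇒ B) (f : ⟦ B ∣ Γ ⟧ ⇒ C) (g : ⟦ I ∣ Δ ⟧ ⇒ D)
    → ((f ∘ ⟦ h ∣ Γ ⟧f) ⊗⇒ g) ∘ φ' A Γ Δ ≐ ((f ⊗⇒ g) ∘ φ' B Γ Δ) ∘ ⟦ h ∣ Γ ++ Δ ⟧f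
  φ'-nat-⊗ Γ Δ h f g = (split-∘⊗ˡ ∘≐ refl≐) ∙ ~ ass ∙ (refl≐ ∘≐ ~ φ'-nat Γ Δ h) ∙ ass

  l∘ψ : (Γ : Cxt) → l ∘ ψ I B Γ ≐ ⟦ l ∣ Γ ⟧f
  l∘ψ []      = lid
  l∘ψ (C ∷ Γ) = ass ∙ (l∘ψ Γ ∘≐ refl≐) ∙ ~ ⟦⟧f-∘ Γ ∙ ⟦⟧f-cong Γ lα

  l∘φ' : (Δ : Cxt) → l ∘ φ' I [] Δ ≐ id
  l∘φ' Δ = ass ∙ (l∘ψ Δ ∘≐ refl≐) ∙ ~ ⟦⟧f-∘ Δ ∙ ⟦⟧f-cong Δ lρ ∙ ⟦⟧f-id Δ

  triangle-φ' : (id {A = A} ⊗⇒ l {A = B}) ∘ φ' A [] (B ∷ []) ≐ id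
  triangle-φ' = (refl≐ ∘≐ ~ rid ∘≐ refl≐) ∙ ass ∙ lαρ

  α∘ψ : (Γ : Cxt) → α ∘ ψ (A ⊗ B) D Γ ≐ (id ⊗⇒ ψ B D Γ) ∘ ψ A B (D ∷ Γ)
  α∘ψ []      = lid ∙ rid ∙ (~ f⊗id ∘≐ rid)
  α∘ψ {A = A} {B = B} {D = D} (C ∷ Γ) = begin
    α ∘ (ψ (A ⊗ B) (D ⊗ C) Γ ∘ ⟦ α ∣ Γ ⟧f)
      ≈⟨ ass ∙ (α∘ψ Γ ∘≐ refl≐) ∙ ~ ass ∙ (refl≐ ∘≐ ~ ass) ⟩
    (id ⊗⇒ ψ B (D ⊗ C) Γ) ∘ (ψ A (B ⊗ (D ⊗ C)) Γ ∘ (⟦ α ∣ Γ ⟧f ∘ ⟦ α ∣ Γ ⟧f))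
      ≈⟨ refl≐ ∘≐ refl≐ ∘≐ (~ ⟦⟧f-∘ Γ ∙ ⟦⟧f-cong Γ ααα ∙ ⟦⟧f-∘ Γ ∙ (⟦⟧f-∘ Γ ∘≐ refl≐)) ⟩
    (id ⊗⇒ ψ B (D ⊗ C) Γ) ∘ (ψ A (B ⊗ (D ⊗ C)) Γ ∘ ((⟦ id ⊗⇒ α ∣ Γ ⟧f ∘ ⟦ α ∣ Γ ⟧f) ∘ ⟦ α ⊗⇒ id ∣ Γ ⟧f))
      ≈⟨ refl≐ ∘≐ (ass ∙ ((ass ∙ (ψ-natʳ Γ α ∘≐ refl≐)) ∘≐ refl≐)) ⟩
    (id ⊗⇒ ψ B (D ⊗ C) Γ) ∘ ((((id ⊗⇒ ⟦ α ∣ Γ ⟧f) ∘ ψ A ((B ⊗ D) ⊗ C) Γ) ∘ ⟦ α ∣ Γ ⟧f) ∘ ⟦ α ⊗⇒ id ∣ Γ ⟧f)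
      ≈⟨ (refl≐ ∘≐ ~ ass ∘≐ refl≐) ∙ (refl≐ ∘≐ ~ ass) ∙ ass ⟩
    ((id ⊗⇒ ψ B (D ⊗ C) Γ) ∘ (id ⊗⇒ ⟦ α ∣ Γ ⟧f)) ∘ ψ A B (D ∷ C ∷ Γ)
      ≈⟨ id⊗-∘ ∘≐ refl≐ ⟩
    (id ⊗⇒ ψ B D (C ∷ Γ)) ∘ ψ A B (D ∷ C ∷ Γ)
      ∎
    where open ≐-Reasoning

  α-ψ-φ' : (Γ Δ : Cxt) → α ∘ ((ψ A B Γ ⊗⇒ id) ∘ φ' (A ⊗ B) Γ Δ) ≐ (id ⊗⇒ φ' B Γ Δ) ∘ ψ A B (Γ ++ Δ)
  α-ψ-φ' {A = A} {B = B} [] Δ = begin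
    α ∘ ((id ⊗⇒ id) ∘ (ψ (A ⊗ B) I Δ ∘ ⟦ ρ ∣ Δ ⟧f))
      ≈⟨ refl≐ ∘≐ ((f⊗id ∘≐ refl≐) ∙ ~ rid) ⟩
    α ∘ (ψ (A ⊗ B) I Δ ∘ ⟦ ρ ∣ Δ ⟧f)
      ≈⟨ ass ∙ (α∘ψ Δ ∘≐ refl≐) ∙ ~ ass ∙ (refl≐ ∘≐ ~ ass) ⟩
    (id ⊗⇒ ψ B I Δ) ∘ (ψ A (B ⊗ I) Δ ∘ (⟦ α ∣ Δ ⟧f ∘ ⟦ ρ ∣ Δ ⟧f))
      ≈⟨ refl≐ ∘≐ refl≐ ∘≐ (~ ⟦⟧f-∘ Δ ∙ ⟦⟧f-cong Δ αρ) ⟩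
    (id ⊗⇒ ψ B I Δ) ∘ (ψ A (B ⊗ I) Δ ∘ ⟦ id ⊗⇒ ρ ∣ Δ ⟧f)
      ≈⟨ refl≐ ∘≐ ψ-natʳ Δ ρ ⟩
    (id ⊗⇒ ψ B I Δ) ∘ ((id ⊗⇒ ⟦ ρ ∣ Δ ⟧f) ∘ ψ A B Δ)
      ≈⟨ ass ∙ (id⊗-∘ ∘≐ refl≐) ⟩
    (id ⊗⇒ φ' B [] Δ) ∘ ψ A B Δ
      ∎
    where open ≐-Reasoning
  α-ψ-φ' {A = A} {B = B} (C ∷ Γ) Δ = begin
    α ∘ ((ψ A B (C ∷ Γ) ⊗⇒ id) ∘ φ' ((A ⊗ B) ⊗ C) Γ Δ)
      ≈⟨ refl≐ ∘≐ ((split-∘⊗ʳ ∘≐ refl≐) ∙ ~ ass ∙ (refl≐ ∘≐ ~ φ'-nat Γ Δ α) ∙ ass) ⟩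
    α ∘ (((ψ A (B ⊗ C) Γ ⊗⇒ id) ∘ φ' (A ⊗ (B ⊗ C)) Γ Δ) ∘ ⟦ α ∣ Γ ++ Δ ⟧f)
      ≈⟨ ass ∙ (α-ψ-φ' Γ Δ ∘≐ refl≐) ∙ ~ ass ⟩
    (id ⊗⇒ φ' B (C ∷ Γ) Δ) ∘ ψ A B (C ∷ Γ ++ Δ)
      ∎
    where open ≐-Reasoning

  cast⇒ : Γ ≡ Γ' → ⟦ A ∣ Γ' ⟧ ⇒ ⟦ A ∣ Γ ⟧
  cast⇒ refl = id

  cast⇒-∷ : (e : C ∷ Γ ≡ C ∷ Γ') (e' : Γ ≡ Γ') → cast⇒ {A = A} e ≡ cast⇒ {A = A ⊗ C} e'
  cast⇒-∷ refl refl = refl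

  α-φ'-φ' : (Γ Δ Λ : Cxt) → α ∘ ((φ' A Γ Δ ⊗⇒ id) ∘ φ' A (Γ ++ Δ) Λ)
    ≐ (id ⊗⇒ φ' I Δ Λ) ∘ (φ' A Γ (Δ ++ Λ) ∘ cast⇒ (sym (++-assoc Γ Δ Λ)))
  α-φ'-φ' (C ∷ Γ) Δ Λ = α-φ'-φ' Γ Δ Λ ∙ (refl≐ ∘≐ refl≐ ∘≐ ≡→≐ (sym (cast⇒-∷ _ _)))
  α-φ'-φ' {A = A} [] Δ Λ = begin
    α ∘ (((ψ A I Δ ∘ ⟦ ρ ∣ Δ ⟧f) ⊗⇒ id) ∘ φ' A Δ Λ)
      ≈⟨ refl≐ ∘≐ ((split-∘⊗ʳ ∘≐ refl≐) ∙ ~ ass ∙ (refl≐ ∘≐ ~ φ'-nat Δ Λ ρ) ∙ ass) ⟩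
    α ∘ (((ψ A I Δ ⊗⇒ id) ∘ φ' (A ⊗ I) Δ Λ) ∘ ⟦ ρ ∣ Δ ++ Λ ⟧f)
      ≈⟨ ass ∙ (α-ψ-φ' Δ Λ ∘≐ refl≐) ∙ ~ ass ∙ (refl≐ ∘≐ ~ lid) ⟩
    (id ⊗⇒ φ' I Δ Λ) ∘ (φ' A [] (Δ ++ Λ) ∘ id)
      ∎
    where open ≐-Reasoning

  φ'-ρ : (Γ : Cxt) → φ' A Γ [] ∘ cast⇒ (++-identityʳ Γ) ≐ ρ
  φ'-ρ []      = lid ∙ ~ rid
  φ'-ρ (C ∷ Γ) = (refl≐ ∘≐ ≡→≐ (cast⇒-∷ _ _)) ∙ φ'-ρ Γ

  ⊢-setoid : Stp {Var} → Cxt {Var} → Fma {Var} → Setoid _ _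
  ⊢-setoid S Γ C = record
    { Carrier = S ∣ Γ ⊢ C ; _≈_ = _≗_ ; isEquivalence = record { refl = refl≗ ; sym = ~≗_ ; trans = _∙≗_ } }

  module ≗-Reasoning {S : Stp {Var}} {Γ : Cxt {Var}} {C : Fma {Var}} = SetoidReasoning (⊢-setoid S Γ C)

  ≡→≗ : {x y : S ∣ Γ ⊢ C} → x ≡ y → x ≗ y
  ≡→≗ refl = refl≗

  cast⊢ : Γ ≡ Γ' → S ∣ Γ ⊢ C → S ∣ Γ' ⊢ C
  cast⊢ refl x = x

  cast⊢-refl : (e : Γ ≡ Γ) (x : S ∣ Γ ⊢ C) → cast⊢ e x ≡ x
  cast⊢-refl refl x = refl

  -- By K, casts along any two proofs of the same context equation agree.
  cast⊢-cast⊢ : {Γ'' : Cxt} (p : Γ' ≡ Γ'') (q : Γ ≡ Γ') (r : Γ ≡ Γ'') (x : S ∣ Γ ⊢ C)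
    → cast⊢ p (cast⊢ q x) ≡ cast⊢ r x
  cast⊢-cast⊢ refl refl r x = sym (cast⊢-refl r x)

  cast⊢-cong : (e : Γ ≡ Γ') {x y : S ∣ Γ ⊢ C} → x ≗ y → cast⊢ e x ≗ cast⊢ e y
  cast⊢-cong refl p = p

  cast⊢-natural : {T : Stp} (G : ∀ {Γ} → S ∣ Γ ⊢ A → T ∣ Γ ⊢ B) (e : Γ ≡ Γ') (x : S ∣ Γ ⊢ A)
    → G (cast⊢ e x) ≡ cast⊢ e (G x)
  cast⊢-natural G refl x = refl

  cast⊢-natural-++ : {T : Stp} (G : ∀ {Γ} → S ∣ Γ ⊢ A → T ∣ Γ ++ Δ ⊢ B) (e : Γ ≡ Γ') (x : S ∣ Γ ⊢ A)
    → G (cast⊢ e x) ≡ cast⊢ (cong (_++ Δ) e) (G x)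
  cast⊢-natural-++ G refl x = refl

  cast⊢-pass : (e : A ∷ Γ ≡ A ∷ Γ') (e' : Γ ≡ Γ') (x : just A ∣ Γ ⊢ C)
    → cast⊢ e (pass x) ≡ pass (cast⊢ e' x)
  cast⊢-pass e refl x = cast⊢-refl e (pass x)

  cast⊢-Il : (e : Γ ≡ Γ') (x : nothing ∣ Γ ⊢ C) → cast⊢ e (Il x) ≡ Il (cast⊢ e x)
  cast⊢-Il refl x = refl

  cast⊢-⊗l : (e : Γ ≡ Γ') (e' : B ∷ Γ ≡ B ∷ Γ') (x : just A ∣ B ∷ Γ ⊢ C)
    → cast⊢ e (⊗l x) ≡ ⊗l (cast⊢ e' x)
  cast⊢-⊗l refl e' x = cong ⊗l (sym (cast⊢-refl e' x))

  cast⊢-⊗rʳ : (e : Γ ++ Δ ≡ Γ ++ Λ) (e' : Δ ≡ Λ) (x : S ∣ Γ ⊢ A) (y : nothing ∣ Δ ⊢ B)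
    → cast⊢ e (⊗r x y) ≡ ⊗r x (cast⊢ e' y)
  cast⊢-⊗rʳ e refl x y = cast⊢-refl e (⊗r x y)

  -- Postcomposition of derivations with morphisms

  Icut : S ∣ Γ ⊢ I → nothing ∣ Δ ⊢ A → S ∣ Γ ++ Δ ⊢ A
  Icut ax       y = Il y
  Icut Ir       y = y
  Icut (pass x) y = pass (Icut x y)
  Icut (Il x)   y = Il (Icut x y)
  Icut (⊗l x)   y = ⊗l (Icut x y)

  postl : S ∣ Γ ⊢ I ⊗ A → S ∣ Γ ⊢ A
  postl ax       = ⊗l (Il (pass ax))
  postl (pass k) = pass (postl k)
  postl (Il k)   = Il (postl k)
  postl (⊗l k)   = ⊗l (postl k)
  postl (⊗r x y) = Icut x y

  ⊗rα : S ∣ Γ ⊢ A ⊗ B → nothing ∣ Δ ⊢ C → S ∣ Γ ++ Δ ⊢ A ⊗ (B ⊗ C)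
  ⊗rα ax       y = ⊗l (⊗r ax (⊗r (pass ax) y))
  ⊗rα (pass x) y = pass (⊗rα x y)
  ⊗rα (Il x)   y = Il (⊗rα x y)
  ⊗rα (⊗l x)   y = ⊗l (⊗rα x y)
  ⊗rα {Δ = Δ} (⊗r {Γ = Γ} {Δ = Λ} x z) y = cast⊢ (sym (++-assoc Γ Λ Δ)) (⊗r x (⊗r z y))

  postα : S ∣ Γ ⊢ (A ⊗ B) ⊗ C → S ∣ Γ ⊢ A ⊗ (B ⊗ C)
  postα ax       = ⊗l (⊗rα ax (pass ax))
  postα (pass k) = pass (postα k)
  postα (Il k)   = Il (postα k)
  postα (⊗l k)   = ⊗l (postα k)
  postα (⊗r x y) = ⊗rα x y

  postρ : S ∣ Γ ⊢ A → S ∣ Γ ⊢ A ⊗ I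
  postρ {Γ = Γ} k = cast⊢ (++-identityʳ Γ) (⊗r k Ir)

  mutual
    post : A ⇒ B → S ∣ Γ ⊢ A → S ∣ Γ ⊢ B
    post id      k = k
    post (g ∘ f) k = post g (post f k)
    post (f ⊗⇒ g) k = post⊗ f g k
    post l       k = postl k
    post ρ       k = postρ k
    post α       k = postα k

    post⊗ : A ⇒ C → B ⇒ D → S ∣ Γ ⊢ A ⊗ B → S ∣ Γ ⊢ C ⊗ D
    post⊗ f g ax       = ⊗l (⊗r (post f ax) (pass (post g ax)))
    post⊗ f g (pass k) = pass (post⊗ f g k)
    post⊗ f g (Il k)   = Il (post⊗ f g k)
    post⊗ f g (⊗l k)   = ⊗l (post⊗ f g k)
    post⊗ f g (⊗r x y) = ⊗r (post f x) (post g y)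

  Icut-congˡ : {x x' : S ∣ Γ ⊢ I} → x ≗ x' → (y : nothing ∣ Δ ⊢ A) → Icut x y ≗ Icut x' y
  Icut-congˡ refl≗     y = refl≗
  Icut-congˡ (~≗ p)    y = ~≗ Icut-congˡ p y
  Icut-congˡ (p ∙≗ q)  y = Icut-congˡ p y ∙≗ Icut-congˡ q y
  Icut-congˡ (pass≗ p) y = pass≗ (Icut-congˡ p y)
  Icut-congˡ (Il≗ p)   y = Il≗ (Icut-congˡ p y)
  Icut-congˡ (⊗l≗ p)   y = ⊗l≗ (Icut-congˡ p y)
  Icut-congˡ axI       y = refl≗

  Icut-congʳ : (x : S ∣ Γ ⊢ I) {y y' : nothing ∣ Δ ⊢ A} → y ≗ y' → Icut x y ≗ Icut x y'
  Icut-congʳ ax       p = Il≗ p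
  Icut-congʳ Ir       p = p
  Icut-congʳ (pass x) p = pass≗ (Icut-congʳ x p)
  Icut-congʳ (Il x)   p = Il≗ (Icut-congʳ x p)
  Icut-congʳ (⊗l x)   p = ⊗l≗ (Icut-congʳ x p)

  postl-cong : {k k' : S ∣ Γ ⊢ I ⊗ A} → k ≗ k' → postl k ≗ postl k'
  postl-cong refl≗     = refl≗
  postl-cong (~≗ p)    = ~≗ postl-cong p
  postl-cong (p ∙≗ q)  = postl-cong p ∙≗ postl-cong q
  postl-cong (pass≗ p) = pass≗ (postl-cong p)
  postl-cong (Il≗ p)   = Il≗ (postl-cong p)
  postl-cong (⊗l≗ p)   = ⊗l≗ (postl-cong p)
  postl-cong (⊗r≗ {g = x} {f' = y} p q) = Icut-congˡ p y ∙≗ Icut-congʳ x q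
  postl-cong ax⊗       = refl≗
  postl-cong ⊗rpass    = refl≗
  postl-cong ⊗rIl      = refl≗
  postl-cong ⊗r⊗l      = refl≗

  ⊗rα-congˡ : {x x' : S ∣ Γ ⊢ A ⊗ B} → x ≗ x' → (y : nothing ∣ Δ ⊢ C) → ⊗rα x y ≗ ⊗rα x' y
  ⊗rα-congˡ refl≗     y = refl≗
  ⊗rα-congˡ (~≗ p)    y = ~≗ ⊗rα-congˡ p y
  ⊗rα-congˡ (p ∙≗ q)  y = ⊗rα-congˡ p y ∙≗ ⊗rα-congˡ q y
  ⊗rα-congˡ (pass≗ p) y = pass≗ (⊗rα-congˡ p y)
  ⊗rα-congˡ (Il≗ p)   y = Il≗ (⊗rα-congˡ p y)
  ⊗rα-congˡ (⊗l≗ p)   y = ⊗l≗ (⊗rα-congˡ p y)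
  ⊗rα-congˡ (⊗r≗ p q) y = cast⊢-cong _ (⊗r≗ p (⊗r≗ q refl≗))
  ⊗rα-congˡ ax⊗       y = refl≗
  ⊗rα-congˡ (⊗rpass {Γ = Γ} {Δ = Λ}) y =
    cast⊢-cong _ ⊗rpass ∙≗ ≡→≗ (cast⊢-pass _ (sym (++-assoc Γ Λ _)) _)
  ⊗rα-congˡ ⊗rIl      y = cast⊢-cong _ ⊗rIl ∙≗ ≡→≗ (cast⊢-Il _ _)
  ⊗rα-congˡ ⊗r⊗l      y = cast⊢-cong _ ⊗r⊗l ∙≗ ≡→≗ (cast⊢-⊗l _ _ _)

  ⊗rα-congʳ : (x : S ∣ Γ ⊢ A ⊗ B) {y y' : nothing ∣ Δ ⊢ C} → y ≗ y' → ⊗rα x y ≗ ⊗rα x y'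
  ⊗rα-congʳ ax       p = ⊗l≗ (⊗r≗ refl≗ (⊗r≗ refl≗ p))
  ⊗rα-congʳ (pass x) p = pass≗ (⊗rα-congʳ x p)
  ⊗rα-congʳ (Il x)   p = Il≗ (⊗rα-congʳ x p)
  ⊗rα-congʳ (⊗l x)   p = ⊗l≗ (⊗rα-congʳ x p)
  ⊗rα-congʳ (⊗r x z) p = cast⊢-cong _ (⊗r≗ refl≗ (⊗r≗ refl≗ p))

  postα-cong : {k k' : S ∣ Γ ⊢ (A ⊗ B) ⊗ C} → k ≗ k' → postα k ≗ postα k'
  postα-cong refl≗     = refl≗
  postα-cong (~≗ p)    = ~≗ postα-cong p
  postα-cong (p ∙≗ q)  = postα-cong p ∙≗ postα-cong q
  postα-cong (pass≗ p) = pass≗ (postα-cong p)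
  postα-cong (Il≗ p)   = Il≗ (postα-cong p)
  postα-cong (⊗l≗ p)   = ⊗l≗ (postα-cong p)
  postα-cong (⊗r≗ {g = x} {f' = y} p q) = ⊗rα-congˡ p y ∙≗ ⊗rα-congʳ x q
  postα-cong ax⊗       = refl≗
  postα-cong ⊗rpass    = refl≗
  postα-cong ⊗rIl      = refl≗
  postα-cong ⊗r⊗l      = refl≗

  mutual
    post-cong : (h : A ⇒ B) {k k' : S ∣ Γ ⊢ A} → k ≗ k' → post h k ≗ post h k'
    post-cong id       p = p
    post-cong (g ∘ f)  p = post-cong g (post-cong f p)
    post-cong (f ⊗⇒ g) p = post⊗-cong f g p
    post-cong l        p = postl-cong p
    post-cong ρ        p = cast⊢-cong _ (⊗r≗ p refl≗)
    post-cong α        p = postα-cong p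

    post⊗-cong : (f : A ⇒ C) (g : B ⇒ D) {k k' : S ∣ Γ ⊢ A ⊗ B} → k ≗ k' → post⊗ f g k ≗ post⊗ f g k'
    post⊗-cong f g refl≗     = refl≗
    post⊗-cong f g (~≗ p)    = ~≗ post⊗-cong f g p
    post⊗-cong f g (p ∙≗ q)  = post⊗-cong f g p ∙≗ post⊗-cong f g q
    post⊗-cong f g (pass≗ p) = pass≗ (post⊗-cong f g p)
    post⊗-cong f g (Il≗ p)   = Il≗ (post⊗-cong f g p)
    post⊗-cong f g (⊗l≗ p)   = ⊗l≗ (post⊗-cong f g p)
    post⊗-cong f g (⊗r≗ p q) = ⊗r≗ (post-cong f p) (post-cong g q)
    post⊗-cong f g ax⊗       = ⊗l≗ (⊗r≗ refl≗ (~≗ post-pass g ax))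
    post⊗-cong f g (⊗rpass {f = x}) = ⊗r≗ (post-pass f x) refl≗ ∙≗ ⊗rpass
    post⊗-cong f g (⊗rIl {f = x})   = ⊗r≗ (post-Il f x) refl≗ ∙≗ ⊗rIl
    post⊗-cong f g (⊗r⊗l {f = x})   = ⊗r≗ (post-⊗l f x) refl≗ ∙≗ ⊗r⊗l

    post-pass : (h : A ⇒ B) (x : just A' ∣ Γ ⊢ A) → post h (pass x) ≗ pass (post h x)
    post-pass id       x = refl≗
    post-pass (g ∘ f)  x = post-cong g (post-pass f x) ∙≗ post-pass g (post f x)
    post-pass (f ⊗⇒ g) x = refl≗
    post-pass l        x = refl≗
    post-pass {Γ = Γ} ρ x = cast⊢-cong _ ⊗rpass ∙≗ ≡→≗ (cast⊢-pass _ (++-identityʳ Γ) _)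
    post-pass α        x = refl≗

    post-Il : (h : A ⇒ B) (x : nothing ∣ Γ ⊢ A) → post h (Il x) ≗ Il (post h x)
    post-Il id       x = refl≗
    post-Il (g ∘ f)  x = post-cong g (post-Il f x) ∙≗ post-Il g (post f x)
    post-Il (f ⊗⇒ g) x = refl≗
    post-Il l        x = refl≗
    post-Il ρ        x = cast⊢-cong _ ⊗rIl ∙≗ ≡→≗ (cast⊢-Il _ _)
    post-Il α        x = refl≗

    post-⊗l : (h : A ⇒ B) (x : just A' ∣ B' ∷ Γ ⊢ A) → post h (⊗l x) ≗ ⊗l (post h x)
    post-⊗l id       x = refl≗
    post-⊗l (g ∘ f)  x = post-cong g (post-⊗l f x) ∙≗ post-⊗l g (post f x)
    post-⊗l (f ⊗⇒ g) x = refl≗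
    post-⊗l l        x = refl≗
    post-⊗l {Γ = Γ} ρ x = cast⊢-cong _ ⊗r⊗l ∙≗ ≡→≗ (cast⊢-⊗l _ (++-identityʳ (_ ∷ Γ)) _)
    post-⊗l α        x = refl≗

  post⊗-resp : {f f' : A ⇒ C} {g g' : B ⇒ D}
    → (∀ {S Γ} (k : S ∣ Γ ⊢ A) → post f k ≗ post f' k)
    → (∀ {S Γ} (k : S ∣ Γ ⊢ B) → post g k ≗ post g' k)
    → (k : S ∣ Γ ⊢ A ⊗ B) → post⊗ f g k ≗ post⊗ f' g' k
  post⊗-resp pf pg ax       = ⊗l≗ (⊗r≗ (pf ax) (pass≗ (pg ax)))
  post⊗-resp pf pg (pass k) = pass≗ (post⊗-resp pf pg k)
  post⊗-resp pf pg (Il k)   = Il≗ (post⊗-resp pf pg k)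
  post⊗-resp pf pg (⊗l k)   = ⊗l≗ (post⊗-resp pf pg k)
  post⊗-resp pf pg (⊗r x y) = ⊗r≗ (pf x) (pg y)

  post⊗-id : (k : S ∣ Γ ⊢ A ⊗ B) → post⊗ id id k ≗ k
  post⊗-id ax       = ~≗ ax⊗
  post⊗-id (pass k) = pass≗ (post⊗-id k)
  post⊗-id (Il k)   = Il≗ (post⊗-id k)
  post⊗-id (⊗l k)   = ⊗l≗ (post⊗-id k)
  post⊗-id (⊗r x y) = refl≗

  post⊗-∘ : (f : A ⇒ B) (g : D ⇒ E) (h : B ⇒ C) (h' : E ⇒ G) (k : S ∣ Γ ⊢ A ⊗ D)
    → post⊗ (h ∘ f) (h' ∘ g) k ≗ post⊗ h h' (post⊗ f g k)
  post⊗-∘ f g h h' ax       = ⊗l≗ (⊗r≗ refl≗ (~≗ post-pass h' _))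
  post⊗-∘ f g h h' (pass k) = pass≗ (post⊗-∘ f g h h' k)
  post⊗-∘ f g h h' (Il k)   = Il≗ (post⊗-∘ f g h h' k)
  post⊗-∘ f g h h' (⊗l k)   = ⊗l≗ (post⊗-∘ f g h h' k)
  post⊗-∘ f g h h' (⊗r x y) = refl≗

  post-Icut : (f : A ⇒ B) (x : S ∣ Γ ⊢ I) (y : nothing ∣ Δ ⊢ A) → post f (Icut x y) ≗ Icut x (post f y)
  post-Icut f ax       y = post-Il f y
  post-Icut f Ir       y = refl≗
  post-Icut f (pass x) y = post-pass f _ ∙≗ pass≗ (post-Icut f x y)
  post-Icut f (Il x)   y = post-Il f _ ∙≗ Il≗ (post-Icut f x y)
  post-Icut f (⊗l x)   y = post-⊗l f _ ∙≗ ⊗l≗ (post-Icut f x y)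

  postl-natural : (f : A ⇒ B) (k : S ∣ Γ ⊢ I ⊗ A) → postl (post⊗ id f k) ≗ post f (postl k)
  postl-natural f ax       = ~≗ (post-⊗l f _ ∙≗ ⊗l≗ (post-Il f _ ∙≗ Il≗ (post-pass f ax)))
  postl-natural f (pass k) = pass≗ (postl-natural f k) ∙≗ ~≗ post-pass f _
  postl-natural f (Il k)   = Il≗ (postl-natural f k) ∙≗ ~≗ post-Il f _
  postl-natural f (⊗l k)   = ⊗l≗ (postl-natural f k) ∙≗ ~≗ post-⊗l f _
  postl-natural f (⊗r x y) = ~≗ post-Icut f x y

  ⊗rα-natural : (f : A ⇒ D) (g : B ⇒ E) (h : C ⇒ G) (x : S ∣ Γ ⊢ A ⊗ B) (y : nothing ∣ Δ ⊢ C)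
    → post⊗ f (g ⊗⇒ h) (⊗rα x y) ≗ ⊗rα (post⊗ f g x) (post h y)
  ⊗rα-natural f g h ax       y = ⊗l≗ (⊗r≗ refl≗ (⊗r≗ (post-pass g ax) refl≗))
  ⊗rα-natural f g h (pass x) y = pass≗ (⊗rα-natural f g h x y)
  ⊗rα-natural f g h (Il x)   y = Il≗ (⊗rα-natural f g h x y)
  ⊗rα-natural f g h (⊗l x)   y = ⊗l≗ (⊗rα-natural f g h x y)
  ⊗rα-natural {Δ = Δ} f g h (⊗r {Γ = Γ} {Δ = Λ} x z) y =
    ≡→≗ (cast⊢-natural (post⊗ f (g ⊗⇒ h)) (sym (++-assoc Γ Λ Δ)) (⊗r x (⊗r z y)))

  postα-natural : (f : A ⇒ D) (g : B ⇒ E) (h : C ⇒ G) (k : S ∣ Γ ⊢ (A ⊗ B) ⊗ C)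
    → post⊗ f (g ⊗⇒ h) (postα k) ≗ postα (post⊗ (f ⊗⇒ g) h k)
  postα-natural f g h ax       = ⊗l≗ (⊗l≗ (⊗r≗ refl≗ (⊗r≗ (post-pass g ax) (post-pass h ax))))
  postα-natural f g h (pass k) = pass≗ (postα-natural f g h k)
  postα-natural f g h (Il k)   = Il≗ (postα-natural f g h k)
  postα-natural f g h (⊗l k)   = ⊗l≗ (postα-natural f g h k)
  postα-natural f g h (⊗r x y) = ⊗rα-natural f g h x y

  Icut-Ir : (e : Γ ++ [] ≡ Γ) (k : S ∣ Γ ⊢ I) → cast⊢ e (Icut k Ir) ≗ k
  Icut-Ir e ax = ≡→≗ (cast⊢-refl e _) ∙≗ ~≗ axI
  Icut-Ir e Ir = ≡→≗ (cast⊢-refl e _)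
  Icut-Ir {Γ = A ∷ Γ} e (pass k) = ≡→≗ (cast⊢-pass e (++-identityʳ Γ) _) ∙≗ pass≗ (Icut-Ir _ k)
  Icut-Ir e (Il k) = ≡→≗ (cast⊢-Il e _) ∙≗ Il≗ (Icut-Ir e k)
  Icut-Ir {Γ = Γ} e (⊗l {B = B} k) = ≡→≗ (cast⊢-⊗l e (++-identityʳ (B ∷ Γ)) _) ∙≗ ⊗l≗ (Icut-Ir _ k)

  postl-postρ : (k : S ∣ Γ ⊢ I) → postl (postρ k) ≗ k
  postl-postρ {Γ = Γ} k = ≡→≗ (cast⊢-natural postl (++-identityʳ Γ) _) ∙≗ Icut-Ir _ k

  post-triangle : (k : S ∣ Γ ⊢ A ⊗ B) → post⊗ id l (postα (post⊗ ρ id k)) ≗ k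
  post-triangle ax       = ~≗ ax⊗
  post-triangle (pass k) = pass≗ (post-triangle k)
  post-triangle (Il k)   = Il≗ (post-triangle k)
  post-triangle (⊗l k)   = ⊗l≗ (post-triangle k)
  post-triangle (⊗r {Γ = Γ} {Δ = Δ} x y) = ≡→≗ (begin
    post⊗ id l (⊗rα (cast⊢ (++-identityʳ Γ) (⊗r x Ir)) y)
      ≡⟨ cong (post⊗ id l) (cast⊢-natural-++ (λ z → ⊗rα z y) (++-identityʳ Γ) (⊗r x Ir)) ⟩
    post⊗ id l (cast⊢ e₁ (cast⊢ e₂ (⊗r x (⊗r Ir y))))
      ≡⟨ cast⊢-natural (post⊗ id l) e₁ _ ⟩
    cast⊢ e₁ (post⊗ id l (cast⊢ e₂ (⊗r x (⊗r Ir y))))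
      ≡⟨ cong (cast⊢ e₁) (cast⊢-natural (post⊗ id l) e₂ _) ⟩
    cast⊢ e₁ (cast⊢ e₂ (⊗r x y))
      ≡⟨ cast⊢-cast⊢ e₁ e₂ refl (⊗r x y) ⟩
    ⊗r x y
      ∎)
    where
      open ≡-Reasoning
      e₁ = cong (_++ Δ) (++-identityʳ Γ)
      e₂ = sym (++-assoc Γ [] Δ)

  Icut-⊗r : (e : Γ ++ (Δ ++ Λ) ≡ (Γ ++ Δ) ++ Λ)
    (x : S ∣ Γ ⊢ I) (z : nothing ∣ Δ ⊢ A) (y : nothing ∣ Λ ⊢ B)
    → cast⊢ e (Icut x (⊗r z y)) ≗ ⊗r (Icut x z) y
  Icut-⊗r e ax z y = ≡→≗ (cast⊢-refl e _) ∙≗ ~≗ ⊗rIl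
  Icut-⊗r e Ir z y = ≡→≗ (cast⊢-refl e _)
  Icut-⊗r {Δ = Δ} {Λ = Λ} e (pass {Γ = Γ} x) z y =
    ≡→≗ (cast⊢-pass e (sym (++-assoc Γ Δ Λ)) _) ∙≗ pass≗ (Icut-⊗r _ x z y) ∙≗ ~≗ ⊗rpass
  Icut-⊗r e (Il x) z y = ≡→≗ (cast⊢-Il e _) ∙≗ Il≗ (Icut-⊗r e x z y) ∙≗ ~≗ ⊗rIl
  Icut-⊗r {Δ = Δ} {Λ = Λ} e (⊗l {Γ = Γ} {B = B} x) z y =
    ≡→≗ (cast⊢-⊗l e (sym (++-assoc (B ∷ Γ) Δ Λ)) _) ∙≗ ⊗l≗ (Icut-⊗r _ x z y) ∙≗ ~≗ ⊗r⊗l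

  postl-⊗rα : (x : S ∣ Γ ⊢ I ⊗ A) (y : nothing ∣ Δ ⊢ B) → postl (⊗rα x y) ≗ ⊗r (postl x) y
  postl-⊗rα ax       y = ~≗ (⊗r⊗l ∙≗ ⊗l≗ ⊗rIl)
  postl-⊗rα (pass x) y = pass≗ (postl-⊗rα x y) ∙≗ ~≗ ⊗rpass
  postl-⊗rα (Il x)   y = Il≗ (postl-⊗rα x y) ∙≗ ~≗ ⊗rIl
  postl-⊗rα (⊗l x)   y = ⊗l≗ (postl-⊗rα x y) ∙≗ ~≗ ⊗r⊗l
  postl-⊗rα {Δ = Δ} (⊗r {Γ = Γ} {Δ = Λ} x z) y =
    ≡→≗ (cast⊢-natural postl (sym (++-assoc Γ Λ Δ)) _) ∙≗ Icut-⊗r _ x z y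

  postl-postα : (k : S ∣ Γ ⊢ (I ⊗ A) ⊗ B) → postl (postα k) ≗ post⊗ l id k
  postl-postα ax       = ⊗l≗ (~≗ (⊗r⊗l ∙≗ ⊗l≗ ⊗rIl))
  postl-postα (pass k) = pass≗ (postl-postα k)
  postl-postα (Il k)   = Il≗ (postl-postα k)
  postl-postα (⊗l k)   = ⊗l≗ (postl-postα k)
  postl-postα (⊗r x y) = postl-⊗rα x y

  ⊗rα-Ir : (e : Γ ++ [] ≡ Γ) (k : S ∣ Γ ⊢ A ⊗ B) → cast⊢ e (⊗rα k Ir) ≗ post⊗ id ρ k
  ⊗rα-Ir e ax = ≡→≗ (cast⊢-refl e _) ∙≗ ⊗l≗ (⊗r≗ refl≗ ⊗rpass)
  ⊗rα-Ir e (pass {Γ = Γ} k) = ≡→≗ (cast⊢-pass e (++-identityʳ Γ) _) ∙≗ pass≗ (⊗rα-Ir _ k)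
  ⊗rα-Ir e (Il k) = ≡→≗ (cast⊢-Il e _) ∙≗ Il≗ (⊗rα-Ir e k)
  ⊗rα-Ir e (⊗l {Γ = Γ} {B = B} k) = ≡→≗ (cast⊢-⊗l e (++-identityʳ (B ∷ Γ)) _) ∙≗ ⊗l≗ (⊗rα-Ir _ k)
  ⊗rα-Ir e (⊗r {Γ = Γ} {Δ = Δ} x z) = ≡→≗ (begin
    cast⊢ e (cast⊢ (sym (++-assoc Γ Δ [])) (⊗r x (⊗r z Ir)))
      ≡⟨ cast⊢-cast⊢ e (sym (++-assoc Γ Δ [])) _ _ ⟩
    cast⊢ (cong (Γ ++_) (++-identityʳ Δ)) (⊗r x (⊗r z Ir))
      ≡⟨ cast⊢-⊗rʳ _ (++-identityʳ Δ) x _ ⟩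
    ⊗r x (postρ z)
      ∎)
    where open ≡-Reasoning

  postα-postρ : (k : S ∣ Γ ⊢ A ⊗ B) → postα (postρ k) ≗ post⊗ id ρ k
  postα-postρ {Γ = Γ} k = ≡→≗ (cast⊢-natural postα (++-identityʳ Γ) _) ∙≗ ⊗rα-Ir _ k

  ⊗rα-⊗r : (x : S ∣ Γ ⊢ A ⊗ B) (z : nothing ∣ Δ ⊢ C) (y : nothing ∣ Λ ⊢ D)
    → cast⊢ (sym (++-assoc Γ Δ Λ)) (⊗rα x (⊗r z y)) ≗ post⊗ id α (⊗rα (⊗rα x z) y)
  ⊗rα-⊗r ax       z y = refl≗
  ⊗rα-⊗r (pass x) z y = ≡→≗ (cast⊢-pass _ _ _) ∙≗ pass≗ (⊗rα-⊗r x z y)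
  ⊗rα-⊗r (Il x)   z y = ≡→≗ (cast⊢-Il _ _) ∙≗ Il≗ (⊗rα-⊗r x z y)
  ⊗rα-⊗r {Δ = Δ} {Λ = Λ} (⊗l {Γ = Γ} {B = B} x) z y =
    ≡→≗ (cast⊢-⊗l _ (sym (++-assoc (B ∷ Γ) Δ Λ)) _) ∙≗ ⊗l≗ (⊗rα-⊗r x z y)
  ⊗rα-⊗r {Δ = Δ} {Λ = Λ} (⊗r {Γ = Γ₁} {Δ = Γ₂} x w) z y = ≡→≗ (begin
    cast⊢ (sym (++-assoc (Γ₁ ++ Γ₂) Δ Λ)) (cast⊢ (sym (++-assoc Γ₁ Γ₂ (Δ ++ Λ))) W)
      ≡⟨ cast⊢-cast⊢ (sym (++-assoc (Γ₁ ++ Γ₂) Δ Λ)) _ (trans (trans e₃ e₂) e₁) W ⟩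
    cast⊢ (trans (trans e₃ e₂) e₁) W
      ≡⟨ cast⊢-cast⊢ e₁ (trans e₃ e₂) _ W ⟨
    cast⊢ e₁ (cast⊢ (trans e₃ e₂) W)
      ≡⟨ cong (cast⊢ e₁) (cast⊢-cast⊢ e₂ e₃ _ W) ⟨
    cast⊢ e₁ (cast⊢ e₂ (cast⊢ e₃ W))
      ≡⟨ cong (λ v → cast⊢ e₁ (cast⊢ e₂ v)) (cast⊢-⊗rʳ e₃ (sym (++-assoc Γ₂ Δ Λ)) x _) ⟩
    cast⊢ e₁ (cast⊢ e₂ (post⊗ id α (⊗r x (⊗r (⊗r w z) y))))
      ≡⟨ cong (cast⊢ e₁) (cast⊢-natural (post⊗ id α) e₂ _) ⟨
    cast⊢ e₁ (post⊗ id α (cast⊢ e₂ (⊗r x (⊗r (⊗r w z) y))))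
      ≡⟨ cast⊢-natural (post⊗ id α) e₁ _ ⟨
    post⊗ id α (cast⊢ e₁ (⊗rα (⊗r x (⊗r w z)) y))
      ≡⟨ cong (post⊗ id α) (cast⊢-natural-++ (λ v → ⊗rα v y) (sym (++-assoc Γ₁ Γ₂ Δ)) _) ⟨
    post⊗ id α (⊗rα (⊗rα (⊗r x w) z) y)
      ∎)
    where
      open ≡-Reasoning
      W = ⊗r x (⊗r w (⊗r z y))
      e₁ = cong (_++ Λ) (sym (++-assoc Γ₁ Γ₂ Δ))
      e₂ = sym (++-assoc Γ₁ (Γ₂ ++ Δ) Λ)
      e₃ = cong (Γ₁ ++_) (sym (++-assoc Γ₂ Δ Λ))

  postα-⊗rα : (x : S ∣ Γ ⊢ (A ⊗ B) ⊗ C) (y : nothing ∣ Δ ⊢ D)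
    → postα (⊗rα x y) ≗ post⊗ id α (⊗rα (postα x) y)
  postα-⊗rα ax       y = refl≗
  postα-⊗rα (pass x) y = pass≗ (postα-⊗rα x y)
  postα-⊗rα (Il x)   y = Il≗ (postα-⊗rα x y)
  postα-⊗rα (⊗l x)   y = ⊗l≗ (postα-⊗rα x y)
  postα-⊗rα {Δ = Δ} (⊗r {Γ = Γ} {Δ = Λ} x z) y =
    ≡→≗ (cast⊢-natural postα (sym (++-assoc Γ Λ Δ)) _) ∙≗ ⊗rα-⊗r x z y

  post-pentagon : (k : S ∣ Γ ⊢ ((A ⊗ B) ⊗ C) ⊗ D) → postα (postα k) ≗ post⊗ id α (postα (post⊗ α id k))
  post-pentagon ax       = refl≗
  post-pentagon (pass k) = pass≗ (post-pentagon k)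
  post-pentagon (Il k)   = Il≗ (post-pentagon k)
  post-pentagon (⊗l k)   = ⊗l≗ (post-pentagon k)
  post-pentagon (⊗r x y) = postα-⊗rα x y

  post-resp-≐ : {h h' : A ⇒ B} → h ≐ h' → (k : S ∣ Γ ⊢ A) → post h k ≗ post h' k
  post-resp-≐ refl≐ k = refl≗
  post-resp-≐ (~ p) k = ~≗ post-resp-≐ p k
  post-resp-≐ (p ∙ q) k = post-resp-≐ p k ∙≗ post-resp-≐ q k
  post-resp-≐ (_∘≐_ {f = f} {k = h} p q) k = post-cong f (post-resp-≐ q k) ∙≗ post-resp-≐ p (post h k)
  post-resp-≐ (p ⊗≐ q) k = post⊗-resp (post-resp-≐ p) (post-resp-≐ q) k
  post-resp-≐ lid k = refl≗
  post-resp-≐ rid k = refl≗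
  post-resp-≐ ass k = refl≗
  post-resp-≐ f⊗id k = post⊗-id k
  post-resp-≐ (f⊗∘ {f = f} {g = g} {h = h} {k = h'}) k = post⊗-∘ f g h h' k
  post-resp-≐ (nl {f = f}) k = postl-natural f k
  post-resp-≐ {Γ = Γ} (nρ {f = f}) k = ≡→≗ (cast⊢-natural (post⊗ f id) (++-identityʳ Γ) (⊗r k Ir))
  post-resp-≐ (nα {f = f} {g = g} {h = h}) k = postα-natural f g h k
  post-resp-≐ lρ k = postl-postρ k
  post-resp-≐ lαρ k = post-triangle k
  post-resp-≐ lα k = postl-postα k
  post-resp-≐ αρ k = postα-postρ k
  post-resp-≐ ααα k = post-pentagon k

  -- Soundness of ≗ and of postcomposition

  sound-resp-≗ : {f g : S ∣ Γ ⊢ C} → f ≗ g → sound f ≐ sound g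
  sound-resp-≗ refl≗     = refl≐
  sound-resp-≗ (~≗ p)    = ~ sound-resp-≗ p
  sound-resp-≗ (p ∙≗ q)  = sound-resp-≗ p ∙ sound-resp-≗ q
  sound-resp-≗ (pass≗ p) = sound-resp-≗ p ∘≐ refl≐
  sound-resp-≗ (Il≗ p)   = sound-resp-≗ p
  sound-resp-≗ (⊗l≗ p)   = sound-resp-≗ p
  sound-resp-≗ (⊗r≗ p q) = (sound-resp-≗ p ⊗≐ sound-resp-≗ q) ∘≐ refl≐
  sound-resp-≗ axI       = refl≐
  sound-resp-≗ ax⊗       = ~ ((refl≐ ⊗≐ ~ rid) ∘≐ refl≐ ∙ triangle-φ')
  sound-resp-≗ (⊗rpass {Γ = Γ} {Δ = Δ} {f = f} {g = g}) = φ'-nat-⊗ Γ Δ l (sound f) (sound g)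
  sound-resp-≗ ⊗rIl      = refl≐
  sound-resp-≗ ⊗r⊗l      = refl≐

  sound-cast⊢ : (e : Γ ≡ Γ') (x : S ∣ Γ ⊢ C) → sound (cast⊢ e x) ≐ sound x ∘ cast⇒ e
  sound-cast⊢ refl x = ~ lid

  sound-Icut : (x : S ∣ Γ ⊢ I) (y : nothing ∣ Δ ⊢ A)
    → sound (Icut x y) ≐ l ∘ ((sound x ⊗⇒ sound y) ∘ φ S Γ Δ)
  sound-Icut {Δ = Δ} ax y = ~ (ass ∙ (nl ∘≐ refl≐) ∙ ~ ass ∙ (refl≐ ∘≐ l∘φ' Δ) ∙ lid)
  sound-Icut {Δ = Δ} Ir y = ~ (ass ∙ (nl ∘≐ refl≐) ∙ ~ ass ∙ (refl≐ ∘≐ l∘φ' Δ) ∙ lid)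
  sound-Icut {Δ = Δ} (pass {Γ = Γ} x) y =
    (sound-Icut x y ∘≐ refl≐) ∙ ~ ass ∙ (refl≐ ∘≐ ~ φ'-nat-⊗ Γ Δ l (sound x) (sound y))
  sound-Icut (Il x) y = sound-Icut x y
  sound-Icut (⊗l x) y = sound-Icut x y

  sound-⊗rα : (x : S ∣ Γ ⊢ A ⊗ B) (y : nothing ∣ Δ ⊢ C)
    → sound (⊗rα x y) ≐ α ∘ ((sound x ⊗⇒ sound y) ∘ φ S Γ Δ)
  sound-⊗rα {Δ = Δ} ax y = α-φ'-ax Δ (sound y)
    where
      α-φ'-ax : (Δ : Cxt) (s : ⟦ I ∣ Δ ⟧ ⇒ C)
        → (id {A = A} ⊗⇒ (((id ∘ l) ⊗⇒ s) ∘ φ' (I ⊗ B) [] Δ)) ∘ φ' A [] (B ∷ Δ)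
          ≐ α ∘ ((id ⊗⇒ s) ∘ φ' (A ⊗ B) [] Δ)
      α-φ'-ax {A = A} {B = B} Δ s = begin
        (id ⊗⇒ (((id ∘ l) ⊗⇒ s) ∘ φ' (I ⊗ B) [] Δ)) ∘ φ' A [] (B ∷ Δ)
          ≈⟨ (refl≐ ⊗≐ φ'-nat-⊗ [] Δ l id s) ∘≐ refl≐ ∙ (~ id⊗-∘ ∘≐ refl≐) ∙ ~ ass ⟩
        (id ⊗⇒ P) ∘ ((id ⊗⇒ ⟦ l ∣ Δ ⟧f) ∘ ((ψ A (I ⊗ B) Δ ∘ ⟦ α ∣ Δ ⟧f) ∘ ⟦ ρ ⊗⇒ id ∣ Δ ⟧f))
          ≈⟨ refl≐ ∘≐ ((refl≐ ∘≐ ~ ass) ∙ ass ∙ (~ ψ-natʳ Δ l ∘≐ refl≐) ∙ ~ ass) ⟩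
        (id ⊗⇒ P) ∘ (ψ A B Δ ∘ (⟦ id ⊗⇒ l ∣ Δ ⟧f ∘ (⟦ α ∣ Δ ⟧f ∘ ⟦ ρ ⊗⇒ id ∣ Δ ⟧f)))
          ≈⟨ refl≐ ∘≐ refl≐ ∘≐ ((refl≐ ∘≐ ~ ⟦⟧f-∘ Δ) ∙ ~ ⟦⟧f-∘ Δ ∙ ⟦⟧f-cong Δ (ass ∙ lαρ) ∙ ⟦⟧f-id Δ) ⟩
        (id ⊗⇒ P) ∘ (ψ A B Δ ∘ id)
          ≈⟨ refl≐ ∘≐ lid ⟩
        (id ⊗⇒ P) ∘ ψ A B Δ
          ≈⟨ ~ id⊗-∘ ∘≐ refl≐ ∙ ~ ass ⟩
        (id ⊗⇒ (id ⊗⇒ s)) ∘ ((id ⊗⇒ φ' B [] Δ) ∘ ψ A B Δ)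
          ≈⟨ refl≐ ∘≐ α-ψ-φ' [] Δ ⟨
        (id ⊗⇒ (id ⊗⇒ s)) ∘ (α ∘ ((id ⊗⇒ id) ∘ φ' (A ⊗ B) [] Δ))
          ≈⟨ refl≐ ∘≐ refl≐ ∘≐ (f⊗id ∘≐ refl≐ ∙ ~ rid) ⟩
        (id ⊗⇒ (id ⊗⇒ s)) ∘ (α ∘ φ' (A ⊗ B) [] Δ)
          ≈⟨ ass ∙ ((nα ∙ (refl≐ ∘≐ f⊗id ⊗≐ refl≐)) ∘≐ refl≐) ∙ ~ ass ⟩
        α ∘ ((id ⊗⇒ s) ∘ φ' (A ⊗ B) [] Δ)
          ∎
        where
          open ≐-Reasoning
          P = (id ⊗⇒ s) ∘ φ' B [] Δ
  sound-⊗rα {Δ = Δ} (pass {Γ = Γ} x) y =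
    (sound-⊗rα x y ∘≐ refl≐) ∙ ~ ass ∙ (refl≐ ∘≐ ~ φ'-nat-⊗ Γ Δ l (sound x) (sound y))
  sound-⊗rα (Il x) y = sound-⊗rα x y
  sound-⊗rα (⊗l x) y = sound-⊗rα x y
  sound-⊗rα {S = S} {Δ = Δ} (⊗r {Γ = Γ} {Δ = Λ} x z) y = sound-cast⊢ _ (⊗r x (⊗r z y)) ∙ ~ (begin
    α ∘ ((((sound x ⊗⇒ sound z) ∘ φ S Γ Λ) ⊗⇒ sound y) ∘ φ S (Γ ++ Λ) Δ)
      ≈⟨ refl≐ ∘≐ ((split-∘⊗ˡ ∘≐ refl≐) ∙ ~ ass) ∙ ass ∙ (~ nα ∘≐ refl≐) ∙ ~ ass ⟩
    (sound x ⊗⇒ (sound z ⊗⇒ sound y)) ∘ (α ∘ ((φ S Γ Λ ⊗⇒ id) ∘ φ S (Γ ++ Λ) Δ))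
      ≈⟨ refl≐ ∘≐ α-φ'-φ' Γ Λ Δ ⟩
    (sound x ⊗⇒ (sound z ⊗⇒ sound y)) ∘ ((id ⊗⇒ φ' I Λ Δ) ∘ (φ S Γ (Λ ++ Δ) ∘ cast⇒ (sym (++-assoc Γ Λ Δ))))
      ≈⟨ ass ∙ (~ split-⊗∘ ∘≐ refl≐) ∙ ass ⟩
    ((sound x ⊗⇒ ((sound z ⊗⇒ sound y) ∘ φ' I Λ Δ)) ∘ φ S Γ (Λ ++ Δ)) ∘ cast⇒ (sym (++-assoc Γ Λ Δ))
      ∎)
    where open ≐-Reasoning

  sound-post⊗ : (f : A ⇒ C) (g : B ⇒ D)
    → (∀ {S Γ} (k : S ∣ Γ ⊢ A) → sound (post f k) ≐ f ∘ sound k)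
    → (∀ {S Γ} (k : S ∣ Γ ⊢ B) → sound (post g k) ≐ g ∘ sound k)
    → (k : S ∣ Γ ⊢ A ⊗ B) → sound (post⊗ f g k) ≐ (f ⊗⇒ g) ∘ sound k
  sound-post⊗ f g sf sg ax =
    (((sf ax ∙ lid) ⊗≐ ((sg ax ∙ lid) ∘≐ refl≐)) ∙ split-⊗∘) ∘≐ refl≐ ∙ ~ ass ∙ (refl≐ ∘≐ triangle-φ')
  sound-post⊗ f g sf sg (pass k) = (sound-post⊗ f g sf sg k ∘≐ refl≐) ∙ ~ ass
  sound-post⊗ f g sf sg (Il k)   = sound-post⊗ f g sf sg k
  sound-post⊗ f g sf sg (⊗l k)   = sound-post⊗ f g sf sg k
  sound-post⊗ f g sf sg (⊗r x y) = ((sf x ⊗≐ sg y) ∙ f⊗∘) ∘≐ refl≐ ∙ ~ ass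

  sound-postl : (k : S ∣ Γ ⊢ I ⊗ A) → sound (postl k) ≐ l ∘ sound k
  sound-postl ax       = ~ rid ∙ ~ lid
  sound-postl (pass k) = (sound-postl k ∘≐ refl≐) ∙ ~ ass
  sound-postl (Il k)   = sound-postl k
  sound-postl (⊗l k)   = sound-postl k
  sound-postl (⊗r x y) = sound-Icut x y

  sound-postα : (k : S ∣ Γ ⊢ (A ⊗ B) ⊗ C) → sound (postα k) ≐ α ∘ sound k
  sound-postα ax       = sound-⊗rα ax (pass ax) ∙ (refl≐ ∘≐ ~ sound-resp-≗ ax⊗)
  sound-postα (pass k) = (sound-postα k ∘≐ refl≐) ∙ ~ ass
  sound-postα (Il k)   = sound-postα k
  sound-postα (⊗l k)   = sound-postα k
  sound-postα (⊗r x y) = sound-⊗rα x y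

  sound-postρ : (k : S ∣ Γ ⊢ A) → sound (postρ k) ≐ ρ ∘ sound k
  sound-postρ {Γ = Γ} k = sound-cast⊢ (++-identityʳ Γ) (⊗r k Ir) ∙ ~ ass ∙ (refl≐ ∘≐ φ'-ρ Γ) ∙ nρ

  sound-post : (h : A ⇒ B) (k : S ∣ Γ ⊢ A) → sound (post h k) ≐ h ∘ sound k
  sound-post id       k = rid
  sound-post (g ∘ f)  k = sound-post g (post f k) ∙ (refl≐ ∘≐ sound-post f k) ∙ ass
  sound-post (f ⊗⇒ g) k = sound-post⊗ f g (sound-post f) (sound-post g) k
  sound-post l        k = sound-postl k
  sound-post ρ        k = sound-postρ k
  sound-post α        k = sound-postα k

  -- Canonical derivations and inverses of the left rules

  ⊗r-ax* : S ∣ Γ ⊢ A → (Δ : Cxt) → S ∣ Γ ++ Δ ⊢ ⟦ A ∣ Δ ⟧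
  ⊗r-ax* {Γ = Γ} x []      = cast⊢ (sym (++-identityʳ Γ)) x
  ⊗r-ax* {Γ = Γ} x (C ∷ Δ) = cast⊢ (++-assoc Γ (C ∷ []) Δ) (⊗r-ax* (⊗r x (pass ax)) Δ)

  ⊗r-ax*-cong : {x x' : S ∣ Γ ⊢ A} → x ≗ x' → (Δ : Cxt) → ⊗r-ax* x Δ ≗ ⊗r-ax* x' Δ
  ⊗r-ax*-cong p []      = cast⊢-cong _ p
  ⊗r-ax*-cong p (C ∷ Δ) = cast⊢-cong _ (⊗r-ax*-cong (⊗r≗ p refl≗) Δ)

  ⊗r-ax*-pass : (x : just A ∣ Γ ⊢ B) (Δ : Cxt) → ⊗r-ax* (pass x) Δ ≗ pass (⊗r-ax* x Δ)
  ⊗r-ax*-pass x []      = ≡→≗ (cast⊢-pass _ _ x)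
  ⊗r-ax*-pass x (C ∷ Δ) =
    cast⊢-cong _ (⊗r-ax*-cong ⊗rpass Δ ∙≗ ⊗r-ax*-pass (⊗r x (pass ax)) Δ) ∙≗ ≡→≗ (cast⊢-pass _ _ _)

  ⊗r-ax*-Il : (x : nothing ∣ Γ ⊢ B) (Δ : Cxt) → ⊗r-ax* (Il x) Δ ≗ Il (⊗r-ax* x Δ)
  ⊗r-ax*-Il x []      = ≡→≗ (cast⊢-Il _ x)
  ⊗r-ax*-Il x (C ∷ Δ) =
    cast⊢-cong _ (⊗r-ax*-cong ⊗rIl Δ ∙≗ ⊗r-ax*-Il (⊗r x (pass ax)) Δ) ∙≗ ≡→≗ (cast⊢-Il _ _)

  ⊗r-ax*-⊗l : (x : just A ∣ B ∷ Γ ⊢ D) (Δ : Cxt) → ⊗r-ax* (⊗l x) Δ ≗ ⊗l (⊗r-ax* x Δ)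
  ⊗r-ax*-⊗l x []      = ≡→≗ (cast⊢-⊗l _ _ x)
  ⊗r-ax*-⊗l x (C ∷ Δ) =
    cast⊢-cong _ (⊗r-ax*-cong ⊗r⊗l Δ ∙≗ ⊗r-ax*-⊗l (⊗r x (pass ax)) Δ) ∙≗ ≡→≗ (cast⊢-⊗l _ _ _)

  post-⊗r-ax* : (h : A ⇒ B) (x : S ∣ Γ ⊢ A) (Δ : Cxt)
    → post ⟦ h ∣ Δ ⟧f (⊗r-ax* x Δ) ≗ ⊗r-ax* (post h x) Δ
  post-⊗r-ax* {Γ = Γ} h x [] = ≡→≗ (cast⊢-natural (post h) (sym (++-identityʳ Γ)) x)
  post-⊗r-ax* {Γ = Γ} h x (C ∷ Δ) =
    ≡→≗ (cast⊢-natural (post ⟦ h ⊗⇒ id ∣ Δ ⟧f) (++-assoc Γ (C ∷ []) Δ) _)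
    ∙≗ cast⊢-cong _ (post-⊗r-ax* (h ⊗⇒ id) (⊗r x (pass ax)) Δ)

  ψ-⊗r-ax* : (x : S ∣ Γ ⊢ A) (y : nothing ∣ Δ ⊢ B) (Λ : Cxt)
    → post (ψ A B Λ) (⊗r-ax* (⊗r x y) Λ) ≗ cast⊢ (sym (++-assoc Γ Δ Λ)) (⊗r x (⊗r-ax* y Λ))
  ψ-⊗r-ax* {Γ = Γ} {Δ = Δ} x y [] = ≡→≗ (begin
    cast⊢ (sym (++-identityʳ (Γ ++ Δ))) (⊗r x y)
      ≡⟨ cast⊢-cast⊢ (sym (++-assoc Γ Δ [])) (cong (Γ ++_) (sym (++-identityʳ Δ))) _ (⊗r x y) ⟨
    cast⊢ (sym (++-assoc Γ Δ [])) (cast⊢ (cong (Γ ++_) (sym (++-identityʳ Δ))) (⊗r x y))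
      ≡⟨ cong (cast⊢ _) (cast⊢-⊗rʳ _ (sym (++-identityʳ Δ)) x y) ⟩
    cast⊢ (sym (++-assoc Γ Δ [])) (⊗r x (⊗r-ax* y []))
      ∎)
    where open ≡-Reasoning
  ψ-⊗r-ax* {Γ = Γ} {A = A} {Δ = Δ} {B = B} x y (C ∷ Λ) = begin
    post ψ' (post ⟦ α ∣ Λ ⟧f (cast⊢ e (⊗r-ax* (⊗r (⊗r x y) (pass ax)) Λ)))
      ≡⟨ trans (cong (post ψ') (cast⊢-natural (post ⟦ α ∣ Λ ⟧f) e _)) (cast⊢-natural (post ψ') e _) ⟩
    cast⊢ e (post ψ' (post ⟦ α ∣ Λ ⟧f (⊗r-ax* (⊗r (⊗r x y) (pass ax)) Λ)))
      ≈⟨ cast⊢-cong e (post-cong ψ' (post-⊗r-ax* α (⊗r (⊗r x y) (pass ax)) Λ)) ⟩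
    cast⊢ e (post ψ' (⊗r-ax* (cast⊢ (sym (++-assoc Γ Δ (C ∷ []))) (⊗r x Y)) Λ))
      ≡⟨ cong (λ v → cast⊢ e (post ψ' v)) (cast⊢-natural-++ (λ v → ⊗r-ax* v Λ) _ (⊗r x Y)) ⟩
    cast⊢ e (post ψ' (cast⊢ e₁ (⊗r-ax* (⊗r x Y) Λ)))
      ≡⟨ cong (cast⊢ e) (cast⊢-natural (post ψ') e₁ _) ⟩
    cast⊢ e (cast⊢ e₁ (post ψ' (⊗r-ax* (⊗r x Y) Λ)))
      ≈⟨ cast⊢-cong e (cast⊢-cong e₁ (ψ-⊗r-ax* x Y Λ)) ⟩
    cast⊢ e (cast⊢ e₁ (cast⊢ e₂ W))
      ≡⟨ trans (cong (cast⊢ e) (cast⊢-cast⊢ e₁ e₂ _ W)) (cast⊢-cast⊢ e (trans e₂ e₁) r W) ⟩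
    cast⊢ r W
      ≡⟨ cast⊢-cast⊢ (sym (++-assoc Γ Δ (C ∷ Λ))) e₃ r W ⟨
    cast⊢ (sym (++-assoc Γ Δ (C ∷ Λ))) (cast⊢ e₃ W)
      ≡⟨ cong (cast⊢ _) (cast⊢-⊗rʳ e₃ (++-assoc Δ (C ∷ []) Λ) x _) ⟩
    cast⊢ (sym (++-assoc Γ Δ (C ∷ Λ))) (⊗r x (⊗r-ax* y (C ∷ Λ)))
      ∎
    where
      open ≗-Reasoning
      ψ' = ψ A (B ⊗ C) Λ
      Y = ⊗r y (pass ax)
      W = ⊗r x (⊗r-ax* Y Λ)
      e = ++-assoc (Γ ++ Δ) (C ∷ []) Λ
      e₁ = cong (_++ Λ) (sym (++-assoc Γ Δ (C ∷ [])))
      e₂ = sym (++-assoc Γ (Δ ++ C ∷ []) Λ)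
      e₃ = cong (Γ ++_) (++-assoc Δ (C ∷ []) Λ)
      r = trans e₃ (sym (++-assoc Γ Δ (C ∷ Λ)))

  φ'-⊗r-ax* : (x : S ∣ Λ ⊢ A) (Γ Δ : Cxt)
    → post (φ' A Γ Δ) (⊗r-ax* x (Γ ++ Δ)) ≗ cast⊢ (++-assoc Λ Γ Δ) (⊗r (⊗r-ax* x Γ) (⊗r-ax* Ir Δ))
  φ'-⊗r-ax* {Λ = Λ} {A = A} x [] Δ = begin
    post (ψ A I Δ) (post ⟦ ρ ∣ Δ ⟧f (⊗r-ax* x Δ))
      ≈⟨ post-cong (ψ A I Δ) (post-⊗r-ax* ρ x Δ) ⟩
    post (ψ A I Δ) (⊗r-ax* (cast⊢ (++-identityʳ Λ) (⊗r x Ir)) Δ)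
      ≡⟨ trans (cong (post (ψ A I Δ)) (cast⊢-natural-++ (λ v → ⊗r-ax* v Δ) (++-identityʳ Λ) _))
               (cast⊢-natural (post (ψ A I Δ)) e _) ⟩
    cast⊢ e (post (ψ A I Δ) (⊗r-ax* (⊗r x Ir) Δ))
      ≈⟨ cast⊢-cong e (ψ-⊗r-ax* x Ir Δ) ⟩
    cast⊢ e (cast⊢ (sym (++-assoc Λ [] Δ)) W)
      ≡⟨ cast⊢-cast⊢ e _ r W ⟩
    cast⊢ r W
      ≡⟨ cast⊢-cast⊢ (++-assoc Λ [] Δ) (cong (_++ Δ) (sym (++-identityʳ Λ))) r W ⟨
    cast⊢ (++-assoc Λ [] Δ) (cast⊢ (cong (_++ Δ) (sym (++-identityʳ Λ))) W)
      ≡⟨ cong (cast⊢ _) (cast⊢-natural-++ (λ v → ⊗r v (⊗r-ax* Ir Δ)) (sym (++-identityʳ Λ)) x) ⟨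
    cast⊢ (++-assoc Λ [] Δ) (⊗r (⊗r-ax* x []) (⊗r-ax* Ir Δ))
      ∎
    where
      open ≗-Reasoning
      W = ⊗r x (⊗r-ax* Ir Δ)
      e = cong (_++ Δ) (++-identityʳ Λ)
      r = trans (sym (++-assoc Λ [] Δ)) e
  φ'-⊗r-ax* {Λ = Λ} {A = A} x (C ∷ Γ) Δ = begin
    post (φ' (A ⊗ C) Γ Δ) (cast⊢ e (⊗r-ax* X (Γ ++ Δ)))
      ≡⟨ cast⊢-natural (post (φ' (A ⊗ C) Γ Δ)) e _ ⟩
    cast⊢ e (post (φ' (A ⊗ C) Γ Δ) (⊗r-ax* X (Γ ++ Δ)))
      ≈⟨ cast⊢-cong e (φ'-⊗r-ax* X Γ Δ) ⟩
    cast⊢ e (cast⊢ (++-assoc (Λ ++ C ∷ []) Γ Δ) W)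
      ≡⟨ cast⊢-cast⊢ e _ r W ⟩
    cast⊢ r W
      ≡⟨ cast⊢-cast⊢ (++-assoc Λ (C ∷ Γ) Δ) (cong (_++ Δ) e') r W ⟨
    cast⊢ (++-assoc Λ (C ∷ Γ) Δ) (cast⊢ (cong (_++ Δ) e') W)
      ≡⟨ cong (cast⊢ _) (cast⊢-natural-++ (λ v → ⊗r v (⊗r-ax* Ir Δ)) e' (⊗r-ax* X Γ)) ⟨
    cast⊢ (++-assoc Λ (C ∷ Γ) Δ) (⊗r (⊗r-ax* x (C ∷ Γ)) (⊗r-ax* Ir Δ))
      ∎
    where
      open ≗-Reasoning
      X = ⊗r x (pass ax)
      W = ⊗r (⊗r-ax* X Γ) (⊗r-ax* Ir Δ)
      e = ++-assoc Λ (C ∷ []) (Γ ++ Δ)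
      e' = ++-assoc Λ (C ∷ []) Γ
      r = trans (++-assoc (Λ ++ C ∷ []) Γ Δ) e

  axₛ : (S : Stp {Var}) → S ∣ [] ⊢ t S
  axₛ nothing  = Ir
  axₛ (just A) = ax

  ax* : (S : Stp {Var}) (Γ : Cxt) → S ∣ Γ ⊢ ⟦ S ∣ Γ ⟧ₛ
  ax* S Γ = ⊗r-ax* (axₛ S) Γ

  post-sound-ax* : (f : S ∣ Γ ⊢ C) → post (sound f) (ax* S Γ) ≗ f
  post-sound-ax* ax = refl≗
  post-sound-ax* Ir = refl≗
  post-sound-ax* (pass {Γ = Γ} f) =
    post-cong (sound f) (post-⊗r-ax* l (⊗r Ir (pass ax)) Γ ∙≗ ⊗r-ax*-pass ax Γ)
    ∙≗ post-pass (sound f) _ ∙≗ pass≗ (post-sound-ax* f)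
  post-sound-ax* (Il {Γ = Γ} f) =
    post-cong (sound f) (⊗r-ax*-cong axI Γ ∙≗ ⊗r-ax*-Il Ir Γ)
    ∙≗ post-Il (sound f) _ ∙≗ Il≗ (post-sound-ax* f)
  post-sound-ax* (⊗l {Γ = Γ} f) =
    post-cong (sound f) (⊗r-ax*-cong ax⊗ Γ ∙≗ ⊗r-ax*-⊗l (⊗r ax (pass ax)) Γ)
    ∙≗ post-⊗l (sound f) _ ∙≗ ⊗l≗ (post-sound-ax* f)
  post-sound-ax* {S = S} (⊗r {Γ = Γ} {Δ = Δ} f g) =
    post⊗-cong (sound f) (sound g) (φ'-⊗r-ax* (axₛ S) Γ Δ ∙≗ ≡→≗ (cast⊢-refl _ _))
    ∙≗ ⊗r≗ (post-sound-ax* f) (post-sound-ax* g)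

  ⊗l⁻¹ : just (A ⊗ B) ∣ Γ ⊢ C → just A ∣ B ∷ Γ ⊢ C
  ⊗l⁻¹ ax       = ⊗r ax (pass ax)
  ⊗l⁻¹ (⊗l f)   = f
  ⊗l⁻¹ (⊗r f g) = ⊗r (⊗l⁻¹ f) g

  Il⁻¹ : just I ∣ Γ ⊢ C → nothing ∣ Γ ⊢ C
  Il⁻¹ ax       = Ir
  Il⁻¹ (Il f)   = f
  Il⁻¹ (⊗r f g) = ⊗r (Il⁻¹ f) g

  sound-⊗l⁻¹ : (f : just (A ⊗ B) ∣ Γ ⊢ C) → sound (⊗l⁻¹ f) ≐ sound f
  sound-⊗l⁻¹ ax       = ~ sound-resp-≗ ax⊗
  sound-⊗l⁻¹ (⊗l f)   = refl≐
  sound-⊗l⁻¹ (⊗r f g) = (sound-⊗l⁻¹ f ⊗≐ refl≐) ∘≐ refl≐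

  sound-Il⁻¹ : (f : just I ∣ Γ ⊢ C) → sound (Il⁻¹ f) ≐ sound f
  sound-Il⁻¹ ax       = refl≐
  sound-Il⁻¹ (Il f)   = refl≐
  sound-Il⁻¹ (⊗r f g) = (sound-Il⁻¹ f ⊗≐ refl≐) ∘≐ refl≐

  ⊗l⁻¹* : (Γ : Cxt) → just ⟦ A ∣ Γ ⟧ ∣ [] ⊢ C → just A ∣ Γ ⊢ C
  ⊗l⁻¹* []      f = f
  ⊗l⁻¹* (D ∷ Γ) f = ⊗l⁻¹ (⊗l⁻¹* Γ f)

  sound-⊗l⁻¹* : (Γ : Cxt) (f : just ⟦ A ∣ Γ ⟧ ∣ [] ⊢ C) → sound (⊗l⁻¹* Γ f) ≐ sound f
  sound-⊗l⁻¹* []      f = refl≐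
  sound-⊗l⁻¹* (D ∷ Γ) f = sound-⊗l⁻¹ (⊗l⁻¹* Γ f) ∙ sound-⊗l⁻¹* Γ f

  unfold : (S : Stp) (Γ : Cxt) → just ⟦ S ∣ Γ ⟧ₛ ∣ [] ⊢ C → S ∣ Γ ⊢ C
  unfold nothing  Γ f = Il⁻¹ (⊗l⁻¹* Γ f)
  unfold (just A) Γ f = ⊗l⁻¹* Γ f

  sound-unfold : (S : Stp) (Γ : Cxt) (f : just ⟦ S ∣ Γ ⟧ₛ ∣ [] ⊢ C) → sound (unfold S Γ f) ≐ sound f
  sound-unfold nothing  Γ f = sound-Il⁻¹ (⊗l⁻¹* Γ f) ∙ sound-⊗l⁻¹* Γ f
  sound-unfold (just A) Γ f = sound-⊗l⁻¹* Γ f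

theorem4p13 : {Var : Set} (S : Stp {Var}) (Γ : Cxt {Var}) (C : Fma {Var})
    → ((f g : S ∣ Γ ⊢ C) → f ≗ g → sound f ≐ sound g)
    × ((h : ⟦ S ∣ Γ ⟧ₛ ⇒ C) → Σ (S ∣ Γ ⊢ C) (λ f → h ≐ sound f))
    × ((f g : S ∣ Γ ⊢ C) → sound f ≐ sound g → f ≗ g)
theorem4p13 S Γ C = (λ f g → sound-resp-≗) , surjective , injective
  where
    surjective : (h : ⟦ S ∣ Γ ⟧ₛ ⇒ C) → Σ (S ∣ Γ ⊢ C) (λ f → h ≐ sound f)
    surjective h = unfold S Γ (post h ax) , ~ (sound-unfold S Γ (post h ax) ∙ sound-post h ax ∙ lid)

    injective : (f g : S ∣ Γ ⊢ C) → sound f ≐ sound g → f ≗ g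
    injective f g p = ~≗ post-sound-ax* f ∙≗ post-resp-≐ p (ax* S Γ) ∙≗ post-sound-ax* g
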